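{- For every $s\in\mathcal{Q}$, the function $F_s$ is supported on a subset of $J_s$, and $F_s(c)=1$ for every extremal point $c$ of $J_s$.
   Context: $\mathcal{Q}=\mathbb{Q}^{\ge0}\cup\{\infty\}$; each $s\in\mathcal{Q}$ is written uniquely $s=q/p$ with $p,q\in\mathbb{N}$ coprime ($\infty=1/0$). Define $J_s=\{(\alpha,\beta)\in\mathbb{Z}^2:\ \alpha\equiv q,\ \beta\equiv p \pmod 2;\ \alpha\ge-q;\ \beta\ge-p;\ \alpha+\beta\le p+q-2;\ p\alpha+q\beta\ge0\}$, $P^s_i=(q+2i,-p)$, $Q^s_j=(-q,p+2j)$, $\Lambda=\{(0,0),(0,2),(2,0)\}$. Extremal points of $J_s$: for $s\notin\{0,\infty\}$, the points $P^s_0,P^s_{p-1},Q^s_0,Q^s_{q-1}$; for $s\in\{0,\infty\}$, the unique point of $J_s$. Parents: Farey edges are the geodesics of $\mathbb{H}^2$ joining $q_0/p_0,q_1/p_1\in\mathbb{P}^1\mathbb{Q}$ with $|p_0q_1-p_1q_0|=1$. For $s\in\mathcal{Q}\setminus\{0,1,\infty\}$, the parents $s_0,s_1$ of $s$ are the endpoints of the first Farey edge crossed by the geodesic from $s$ to $\sqrt{ -1}$ (the one nearest $s$); the parents of $1$ are $0,\infty$. Label them so that the parents of $s_1$ are $s_0$ and a point $s'\in\mathcal{Q}$. Functions: for finitely supported $F,G:\mathbb{Z}^2\to\mathbb{Z}$, $F*G(u)=\sum_{x+y=u}F(x)G(y)$; $1\!\!1_U$ is the indicator function of $U$. Set $F_s=1\!\!1_{J_s}$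 for $s\in\{0,1,\infty\}$, and for $s\in\mathcal{Q}\setminus\{0,1,\infty\}$ define inductively $F_s=F_{s_0}*F_{s_1}*1\!\!1_\Lambda-F_{s'}$. (Equivalently, $F_s(\alpha,\beta)$ is the coefficient of $X^{1+\alpha}Y^{1+\beta}Z^{ -1-\alpha-\beta}$ in the Laurent polynomial $f_s$ determined by $f_0=X$, $f_\infty=Y$, $f_{ -1}=Z$ and $f_s=f_{s_0}f_{s_1}(X^2+Y^2+Z^2)/(XYZ)-f_{s'}$ for Farey triangles $s_0s_1s$, $s_0s_1s'$.) -}

module Defs where

open import Data.Nat as ℕ using (ℕ; zero; suc)
open import Data.Nat.Divisibility as ℕD using ()
open import Data.Integer as ℤ using (ℤ; +_; _+_; _-_; _*_; -_; _≤_; _≤?_; ∣_∣)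
open import Data.Integer.Divisibility using (_∣_)
open import Data.Integer.Properties as ℤP using ()
open import Data.Nat.Properties as ℕP using ()
open import Data.Product using (_×_; _,_; proj₁; proj₂)
open import Data.Product.Properties using (≡-dec)
open import Data.Sum using (_⊎_)
open import Data.Bool using (true; false)
open import Data.List using (List; []; _∷_; map; concatMap; filter; upTo; _++_; foldr)
open import Relation.Nullary using (Dec; yes; no; ¬_)
open import Relation.Nullary.Decidable using (_×-dec_)
open import Relation.Binary.PropositionalEquality using (_≡_)

-- An element s = q/p of 𝒬 is given by a pair of coprime naturals
-- (numerator q, denominator p); ∞ = 1/0, 0 = 0/1.

Point : Set
Point = ℤ × ℤ

InJ : ℕ → ℕ → Point → Set
InJ q p (α , β) =
  (2ℤ ∣ (α - + q)) × (2ℤ ∣ (β - + p)) ×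
  (- (+ q) ≤ α) × (- (+ p) ≤ β) ×
  (α + β ≤ (+ p + + q) - + 2) ×
  (+ 0 ≤ (+ p * α + + q * β))
  where 2ℤ = + 2

InJ? : ∀ q p c → Dec (InJ q p c)
InJ? q p (α , β) =
  (2 ℕD.∣? ∣ α - + q ∣) ×-dec (2 ℕD.∣? ∣ β - + p ∣) ×-dec
  (- (+ q) ≤? α) ×-dec (- (+ p) ≤? β) ×-dec
  (α + β ≤? (+ p + + q) - + 2) ×-dec
  (+ 0 ≤? (+ p * α + + q * β))

-- Finitely supported functions ℤ² → ℤ, represented as finite formal sums
-- (lists of (point , coefficient)); `ev F u` is the value at u.

FS : Set
FS = List (Point × ℤ)

ev : FS → Point → ℤ
ev [] u = + 0
ev ((x , a) ∷ F) u with ≡-dec ℤ._≟_ ℤ._≟_ x u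
... | yes _ = a + ev F u
... | no  _ = ev F u

_⋆_ : FS → FS → FS
F ⋆ G = concatMap (λ { ((x₁ , x₂) , a) →
          map (λ { ((y₁ , y₂) , b) → ((x₁ + y₁ , x₂ + y₂) , a * b) }) G }) F

neg : FS → FS
neg = map (λ { (x , a) → (x , - a) })

_⊖_ : FS → FS → FS
F ⊖ G = F ++ neg G

𝟙Λ : FS
𝟙Λ = ((+ 0 , + 0) , + 1) ∷ ((+ 0 , + 2) , + 1) ∷ ((+ 2 , + 0) , + 1) ∷ []

range : ℤ → ℕ → List ℤ
range lo n = map (λ i → lo + + i) (upTo n)

-- indicator of J_s: J_s lies in the box
--   -q ≤ α ≤ 2p+q-2 ,  -p ≤ β ≤ p+2q-2
-- (from α ≥ -q, β ≥ -p, α+β ≤ p+q-2), which we enumerate and filter.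
𝟙J : ℕ → ℕ → FS
𝟙J q p =
  map (λ c → (c , + 1))
    (filter (InJ? q p)
      (concatMap (λ α → map (λ β → (α , β)) (range (- (+ p)) (2 ℕ.* (p ℕ.+ q))))
                 (range (- (+ q)) (2 ℕ.* (p ℕ.+ q)))))

Frac : Set
Frac = ℕ × ℕ

_⊕_ : Frac → Frac → Frac
(a , b) ⊕ (c , d) = (a ℕ.+ c , b ℕ.+ d)

-- Descent in the Farey tree towards the target t = q/p.
-- State: the Farey edge (l , r) (l < r), with F_l, F_r and F_m, where
-- m = l ⊕ r is the current vertex (the vertex with parents l, r).
-- Moving to a child u of m:
--   u = l ⊕ m : parents s₀ = l, s₁ = m, s' = r, so F_u = F_l * F_m * 1_Λ - F_r
--   u = m ⊕ r : parents s₀ = r, s₁ = m, s' = l, so F_u = F_m * F_r * 1_Λ - F_l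
-- The fuel argument only ensures termination; fuel q+p always suffices
-- for coprime (q , p).
data Cmp : Set where lt eq gt : Cmp

cmp : ℕ → ℕ → Cmp
cmp a b with a ℕ.<ᵇ b | b ℕ.<ᵇ a
... | true  | _     = lt
... | false | true  = gt
... | false | false = eq

descend : ℕ → Frac → Frac → Frac → FS → FS → FS → FS
descend zero t l r Fl Fr Fm = []
descend (suc n) (q , p) l r Fl Fr Fm =
  go (cmp (q ℕ.* proj₂ (l ⊕ r)) (proj₁ (l ⊕ r) ℕ.* p))
  where
  m = l ⊕ r
  go : Cmp → FS
  go eq = Fm
  go lt = descend n (q , p) l m Fl Fm (((Fl ⋆ Fm) ⋆ 𝟙Λ) ⊖ Fr)
  go gt = descend n (q , p) m r Fm Fr (((Fm ⋆ Fr) ⋆ 𝟙Λ) ⊖ Fl)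

F : ℕ → ℕ → FS
F q zero = 𝟙J q 0
F zero p = 𝟙J 0 p
F q p = descend (q ℕ.+ p) (q , p) (0 , 1) (1 , 0) (𝟙J 0 1) (𝟙J 1 0) (𝟙J 1 1)

P : ℕ → ℕ → ℤ → Point
P q p i = (+ q + + 2 * i , - (+ p))

Q : ℕ → ℕ → ℤ → Point
Q q p j = (- (+ q) , + p + + 2 * j)

Extremal : ℕ → ℕ → Point → Set
Extremal q p c =
  (¬ (q ≡ 0) × ¬ (p ≡ 0) ×
    (c ≡ P q p (+ 0) ⊎ c ≡ P q p (+ p - + 1) ⊎
     c ≡ Q q p (+ 0) ⊎ c ≡ Q q p (+ q - + 1)))
  ⊎ ((q ≡ 0 ⊎ p ≡ 0) × InJ q p c)

{-# OPTIONS --safe #-}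
-- Induction along the Farey tree. Let a = qa/pa < b = qb/pb be Farey neighbours (qb pa = 1 + qa pb) and
-- s = a ⊕ b. In the coordinates (m , n) of a point (2m − q , 2n − p), J_{q/p} is cut out by m + n < q + p
-- and p m + q n ≥ q p. Summing the lower bounds that J_a and J_b impose on the linear forms of a and of b
-- falls short of the bound for s by exactly one, so J_a + J_b + Λ leaves J_s only at u = P₀(a) + Q₀(b),
-- and only through that decomposition; likewise every extremal point of J_s decomposes uniquely into
-- extremal points of J_a and J_b and a point of Λ. Hence F_a * F_b * 1_Λ is 1 at u and at the extremal
-- points of J_s. The vertex s′ opposite s in its Farey triangle satisfies J_s′ ⊆ J_s ∪ {u}, has u as an
-- extremal point and avoids the extremal points of J_s, so subtracting F_s′ cancels the value at u and
-- keeps the others.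
module Submission where

open import Defs
open import Data.Nat.Base as ℕ using (ℕ; zero; suc; z≤n; s≤s)
import Data.Nat.Properties as ℕ
import Data.Nat.Tactic.RingSolver as ℕ-Solver
open import Data.Nat.Coprimality using (Coprime)
open import Data.Integer.Base as ℤ using (ℤ; +_)
import Data.Integer.Properties as ℤ
open import Data.List.Base using (List; []; _∷_; _++_; map; filter; length; concatMap)
open import Data.List.Relation.Unary.All using (All; []; _∷_)
import Data.List.Relation.Unary.All.Properties as All
import Data.List.Properties as List
open import Data.Product.Base using (∃-syntax; Σ; _×_; _,_; proj₁; proj₂; swap)
open import Data.Product.Properties using (≡-dec; ,-injectiveˡ; ,-injectiveʳ)
open import Data.Sum.Base as Sum using (_⊎_; inj₁; inj₂; [_,_]′)
open import Data.Empty using (⊥)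
open import Function.Base using (_∘_)
open import Relation.Binary.Definitions using (DecidableEquality)
open import Relation.Binary.PropositionalEquality
open import Relation.Nullary.Decidable using (Dec; yes; no; ¬?)
open import Relation.Nullary.Negation using (¬_; contradiction)

module _ where
  open import Data.Integer.Base using (_+_; _-_; _*_; -_)
  open import Data.Integer.Tactic.RingSolver using (solve-∀)

  infixl 6 _⊞_
  _⊞_ : Point → Point → Point
  (x₁ , x₂) ⊞ (y₁ , y₂) = (x₁ + y₁ , x₂ + y₂)

  infix 4 _≟ᴾ_
  _≟ᴾ_ : DecidableEquality Point
  _≟ᴾ_ = ≡-dec ℤ._≟_ ℤ._≟_

  δ : Point → Point → ℤ
  δ c x with x ≟ᴾ c
  ... | yes _ = + 1
  ... | no  _ = + 0

  δ-≡ : ∀ {c x} → x ≡ c → δ c x ≡ + 1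
  δ-≡ {c} {x} x≡c with x ≟ᴾ c
  ... | yes _   = refl
  ... | no  x≢c = contradiction x≡c x≢c

  δ-≢ : ∀ {c x} → x ≢ c → δ c x ≡ + 0
  δ-≢ {c} {x} x≢c with x ≟ᴾ c
  ... | yes x≡c = contradiction x≡c x≢c
  ... | no  _   = refl

  δ≢0⇒≡ : ∀ {c x} → δ c x ≢ + 0 → x ≡ c
  δ≢0⇒≡ {c} {x} δ≢0 with x ≟ᴾ c
  ... | yes x≡c = x≡c
  ... | no  _   = contradiction refl δ≢0

  ∑ : FS → (Point → ℤ) → ℤ
  ∑ []            h = + 0
  ∑ ((x , a) ∷ F) h = a * h x + ∑ F h

  ev≡∑δ : ∀ F c → ev F c ≡ ∑ F (δ c)
  ev≡∑δ []            c = refl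
  ev≡∑δ ((x , a) ∷ F) c with x ≟ᴾ c
  ... | yes _ = cong₂ _+_ (sym (ℤ.*-identityʳ a)) (ev≡∑δ F c)
  ... | no  _ = trans (ev≡∑δ F c) (sym (trans (cong (_+ ∑ F (δ c)) (ℤ.*-zeroʳ a)) (ℤ.+-identityˡ _)))

  ev-++ : ∀ F G c → ev (F ++ G) c ≡ ev F c + ev G c
  ev-++ []            G c = sym (ℤ.+-identityˡ _)
  ev-++ ((x , a) ∷ F) G c with x ≟ᴾ c
  ... | yes _ = trans (cong (_+_ a) (ev-++ F G c)) (sym (ℤ.+-assoc a _ _))
  ... | no  _ = ev-++ F G c

  ev-neg : ∀ F c → ev (neg F) c ≡ - ev F c
  ev-neg []            c = refl
  ev-neg ((x , a) ∷ F) c with x ≟ᴾ c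
  ... | yes _ = trans (cong (_+_ (- a)) (ev-neg F c)) (sym (ℤ.neg-distrib-+ a _))
  ... | no  _ = ev-neg F c

  ev-⊖ : ∀ F G c → ev (F ⊖ G) c ≡ ev F c - ev G c
  ev-⊖ F G c = trans (ev-++ F (neg G) c) (cong (_+_ (ev F c)) (ev-neg G c))

  ev-support : ∀ {P : Point → Set} F x → All (P ∘ proj₁) F → ev F x ≢ + 0 → P x
  ev-support []            x []        ev≢0 = contradiction refl ev≢0
  ev-support ((y , a) ∷ F) x (Py ∷ PF) ev≢0 with y ≟ᴾ x
  ... | yes refl = Py
  ... | no  _    = ev-support F x PF ev≢0

  ∑-++ : ∀ F G h → ∑ (F ++ G) h ≡ ∑ F h + ∑ G h
  ∑-++ []            G h = sym (ℤ.+-identityˡ _)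
  ∑-++ ((x , a) ∷ F) G h = trans (cong (_+_ (a * h x)) (∑-++ F G h)) (sym (ℤ.+-assoc (a * h x) _ _))

  ∑-*ˡ : ∀ F h k → ∑ F (λ x → k * h x) ≡ k * ∑ F h
  ∑-*ˡ []            h k = sym (ℤ.*-zeroʳ k)
  ∑-*ˡ ((x , a) ∷ F) h k =
    trans (cong₂ _+_ (swap-factors a k (h x)) (∑-*ˡ F h k)) (sym (ℤ.*-distribˡ-+ k (a * h x) _))
    where
    swap-factors : ∀ a k y → a * (k * y) ≡ k * (a * y)
    swap-factors = solve-∀

  ∑-minus : ∀ F h h′ → ∑ F (λ x → h x - h′ x) ≡ ∑ F h - ∑ F h′
  ∑-minus []            h h′ = refl
  ∑-minus ((x , a) ∷ F) h h′ =
    trans (cong (_+_ (a * (h x - h′ x))) (∑-minus F h h′)) (regroup a (h x) (h′ x) (∑ F h) (∑ F h′))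
    where
    regroup : ∀ a u v A B → a * (u - v) + (A - B) ≡ (a * u + A) - (a * v + B)
    regroup = solve-∀

  ∑-⋆ : ∀ F G h → ∑ (F ⋆ G) h ≡ ∑ F (λ x → ∑ G (λ y → h (x ⊞ y)))
  ∑-⋆ []                    G h = refl
  ∑-⋆ (((x₁ , x₂) , a) ∷ F) G h =
    trans (∑-++ (map shift G) (F ⋆ G) h) (cong₂ _+_ (∑-shift G) (∑-⋆ F G h))
    where
    shift : Point × ℤ → Point × ℤ
    shift ((y₁ , y₂) , b) = ((x₁ + y₁ , x₂ + y₂) , a * b)
    ∑-shift : ∀ G → ∑ (map shift G) h ≡ a * ∑ G (λ y → h ((x₁ , x₂) ⊞ y))
    ∑-shift []                    = sym (ℤ.*-zeroʳ a)
    ∑-shift (((y₁ , y₂) , b) ∷ G) =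
      trans (cong₂ _+_ (ℤ.*-assoc a b _) (∑-shift G)) (sym (ℤ.*-distribˡ-+ a _ _))

  *-vanishes : ∀ {u v} → (u ≢ + 0 → v ≡ + 0) → u * v ≡ + 0
  *-vanishes {u} {v} v≡0 with u ℤ.≟ + 0
  ... | yes u≡0 = trans (cong (_* v) u≡0) (ℤ.*-zeroˡ v)
  ... | no  u≢0 = trans (cong (u *_) (v≡0 u≢0)) (ℤ.*-zeroʳ u)

  *≢0⇒ˡ≢0 : ∀ {u v} → u * v ≢ + 0 → u ≢ + 0
  *≢0⇒ˡ≢0 {v = v} uv≢0 refl = uv≢0 (ℤ.*-zeroˡ v)

  *≢0⇒ʳ≢0 : ∀ u {v} → u * v ≢ + 0 → v ≢ + 0
  *≢0⇒ʳ≢0 u uv≢0 refl = uv≢0 (ℤ.*-zeroʳ u)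

  remove : Point → FS → FS
  remove y = filter (λ e → ¬? (proj₁ e ≟ᴾ y))

  ∑-split : ∀ F h y → ∑ F h ≡ ev F y * h y + ∑ (remove y F) h
  ∑-split []            h y = refl
  ∑-split ((x , a) ∷ F) h y with x ≟ᴾ y
  ... | yes refl = trans (cong (_+_ (a * h x)) (∑-split F h x)) (collect a (ev F x) (h x) _)
    where
    collect : ∀ a b u r → a * u + (b * u + r) ≡ (a + b) * u + r
    collect = solve-∀
  ... | no  _    = trans (cong (_+_ (a * h x)) (∑-split F h y)) (exchange (a * h x) (ev F y * h y) _)
    where
    exchange : ∀ a b r → a + (b + r) ≡ b + (a + r)
    exchange = solve-∀

  ev-remove-≡ : ∀ F y → ev (remove y F) y ≡ + 0
  ev-remove-≡ []            y = refl
  ev-remove-≡ ((x , a) ∷ F) y with x ≟ᴾ y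
  ... | yes _   = ev-remove-≡ F y
  ... | no  x≢y with x ≟ᴾ y
  ...   | yes x≡y = contradiction x≡y x≢y
  ...   | no  _   = ev-remove-≡ F y

  ev-remove-≢ : ∀ F {x y} → x ≢ y → ev (remove y F) x ≡ ev F x
  ev-remove-≢ []            x≢y = refl
  ev-remove-≢ ((z , a) ∷ F) {x} {y} x≢y with z ≟ᴾ y
  ... | yes refl with z ≟ᴾ x
  ...   | yes z≡x = contradiction (sym z≡x) x≢y
  ...   | no  _   = ev-remove-≢ F x≢y
  ev-remove-≢ ((z , a) ∷ F) {x} {y} x≢y | no _ with z ≟ᴾ x
  ...   | yes _ = cong (_+_ a) (ev-remove-≢ F x≢y)
  ...   | no  _ = ev-remove-≢ F x≢y

  -- Entries of F at the same point may cancel, so the induction removes all of them at once.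
  ∑-vanishes : ∀ F h → (∀ x → ev F x ≢ + 0 → h x ≡ + 0) → ∑ F h ≡ + 0
  ∑-vanishes F = bounded (length F) F ℕ.≤-refl
    where
    bounded : ∀ n F → length F ℕ.≤ n → ∀ h →
              (∀ x → ev F x ≢ + 0 → h x ≡ + 0) → ∑ F h ≡ + 0
    bounded _       []               _         _ _      = refl
    bounded (suc n) F@((y , a) ∷ F′) (s≤s len) h vanish =
      trans (∑-split F h y) (cong₂ _+_ (*-vanishes (vanish y)) (bounded n (remove y F) len′ h vanish′))
      where
      len′ : length (remove y F) ℕ.≤ n
      len′ with y ≟ᴾ y
      ... | yes _   = ℕ.≤-trans (List.length-filter _ F′) len
      ... | no  y≢y = contradiction refl y≢y
      vanish′ : ∀ x → ev (remove y F) x ≢ + 0 → h x ≡ + 0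
      vanish′ x ev≢0 with x ≟ᴾ y
      ... | yes refl = contradiction (ev-remove-≡ F x) ev≢0
      ... | no  x≢y  = vanish x (λ ev≡0 → ev≢0 (trans (ev-remove-≢ F x≢y) ev≡0))

  ∑-cong-supp : ∀ F {h h′} → (∀ x → ev F x ≢ + 0 → h x ≡ h′ x) → ∑ F h ≡ ∑ F h′
  ∑-cong-supp F {h} {h′} h≡h′ =
    ℤ.i-j≡0⇒i≡j _ _ (trans (sym (∑-minus F h h′)) (∑-vanishes F _ difference≡0))
    where
    difference≡0 : ∀ x → ev F x ≢ + 0 → h x - h′ x ≡ + 0
    difference≡0 x ev≢0 = trans (cong (_- h′ x) (h≡h′ x ev≢0)) (ℤ.+-inverseʳ (h′ x))

  ∑-unique : ∀ F h x₀ → (∀ x → ev F x ≢ + 0 → h x ≢ + 0 → x ≡ x₀) →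
             ∑ F h ≡ ev F x₀ * h x₀
  ∑-unique F h x₀ unique = begin
    ∑ F h                      ≡⟨ ∑-cong-supp F concentrated ⟩
    ∑ F (λ x → h x₀ * δ x₀ x)  ≡⟨ ∑-*ˡ F (δ x₀) (h x₀) ⟩
    h x₀ * ∑ F (δ x₀)          ≡⟨ cong (h x₀ *_) (ev≡∑δ F x₀) ⟨
    h x₀ * ev F x₀             ≡⟨ ℤ.*-comm (h x₀) _ ⟩
    ev F x₀ * h x₀             ∎
    where
    open ≡-Reasoning
    concentrated : ∀ x → ev F x ≢ + 0 → h x ≡ h x₀ * δ x₀ x
    concentrated x ev≢0 with x ≟ᴾ x₀
    ... | yes refl = sym (ℤ.*-identityʳ (h x))
    ... | no  x≢x₀ with h x ℤ.≟ + 0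
    ...   | yes h≡0 = trans h≡0 (sym (ℤ.*-zeroʳ (h x₀)))
    ...   | no  h≢0 = contradiction (unique x ev≢0 h≢0) x≢x₀

  ∑∑-vanishes : ∀ F G (g : Point → Point → ℤ) →
                (∀ x y → ev F x ≢ + 0 → ev G y ≢ + 0 → g x y ≡ + 0) →
                ∑ F (λ x → ∑ G (g x)) ≡ + 0
  ∑∑-vanishes F G g vanish =
    ∑-vanishes F _ (λ x evF≢0 → ∑-vanishes G (g x) (λ y → vanish x y evF≢0))

  ∑∑-unique : ∀ F G (g : Point → Point → ℤ) x₀ y₀ →
              (∀ x y → ev F x ≢ + 0 → ev G y ≢ + 0 → g x y ≢ + 0 → x ≡ x₀ × y ≡ y₀) →
              ∑ F (λ x → ∑ G (g x)) ≡ ev F x₀ * (ev G y₀ * g x₀ y₀)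
  ∑∑-unique F G g x₀ y₀ unique = trans
    (∑-cong-supp F λ x evF≢0 →
      ∑-unique G (g x) y₀ λ y evG≢0 g≢0 → proj₂ (unique x y evF≢0 evG≢0 g≢0))
    (∑-unique F _ x₀ λ x evF≢0 g≢0 →
      proj₁ (unique x y₀ evF≢0 (*≢0⇒ˡ≢0 g≢0) (*≢0⇒ʳ≢0 (ev G y₀) g≢0)))

-- Coordinates on J_s

module _ where
  open import Data.Integer.Base using (_+_; _-_; _*_; -_; +≤+)
  open import Data.Integer.Divisibility using (_∣_)
  open import Data.Integer.Divisibility.Signed using (divides; ∣ᵤ⇒∣; ∣⇒∣ᵤ)
  open import Data.Integer.Tactic.RingSolver using (solve-∀)
  open import Algebra.Properties.AbelianGroup ℤ.+-0-abelianGroup using (∙-cancelˡ; ∙-cancelʳ)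

  coord : ℕ → ℕ → ℤ
  coord q m = + 2 * + m - + q

  toPoint : Frac → Frac → Point
  toPoint (q , p) (m , n) = (coord q m , coord p n)

  coord-injective : ∀ q {m m′} → coord q m ≡ coord q m′ → m ≡ m′
  coord-injective q {m} {m′} same =
    ℤ.+-injective (ℤ.*-cancelˡ-≡ (+ 2) (+ m) (+ m′) (∙-cancelʳ (- + q) _ _ same))

  toPoint-injective : ∀ s {c d} → toPoint s c ≡ toPoint s d → c ≡ d
  toPoint-injective (q , p) same =
    cong₂ _,_ (coord-injective q (cong proj₁ same)) (coord-injective p (cong proj₂ same))

  toPoint-⊕ : ∀ s t c d → toPoint (s ⊕ t) (c ⊕ d) ≡ toPoint s c ⊞ toPoint t d
  toPoint-⊕ (q , p) (q′ , p′) (m , n) (m′ , n′) =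
    cong₂ _,_ (additive (+ q) (+ q′) (+ m) (+ m′)) (additive (+ p) (+ p′) (+ n) (+ n′))
    where
    additive : ∀ q q′ m m′ → + 2 * (m + m′) - (q + q′) ≡ (+ 2 * m - q) + (+ 2 * m′ - q′)
    additive = solve-∀

  toPoint-translate : ∀ s c d → toPoint s (c ⊕ d) ≡ toPoint s c ⊞ toPoint (0 , 0) d
  toPoint-translate (q , p) c d =
    trans (cong (λ t → toPoint t (c ⊕ d)) (sym (cong₂ _,_ (ℕ.+-identityʳ q) (ℕ.+-identityʳ p))))
          (toPoint-⊕ (q , p) (0 , 0) c d)

  toPoint-shift : ∀ a s′ c → toPoint (a ⊕ (a ⊕ s′)) (c ⊕ a) ≡ toPoint s′ c
  toPoint-shift (qa , pa) (q′ , p′) (m , n) =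
    cong₂ _,_ (shift (+ qa) (+ q′) (+ m)) (shift (+ pa) (+ p′) (+ n))
    where
    shift : ∀ qa q′ m → + 2 * (m + qa) - (qa + (qa + q′)) ≡ + 2 * m - q′
    shift = solve-∀

  size : Frac → ℕ
  size (m , n) = m ℕ.+ n

  area : Frac → ℕ
  area (q , p) = q ℕ.* p

  weight : Frac → Frac → ℕ
  weight (q , p) (m , n) = p ℕ.* m ℕ.+ q ℕ.* n

  -- For α = 2m − q and β = 2n − p, α + β ≤ p + q − 2 reads m + n < q + p and p α + q β ≥ 0 reads
  -- q p ≤ p m + q n.
  InJᶜ : Frac → Frac → Set
  InJᶜ s c = size c ℕ.< size s × area s ℕ.≤ weight s c

  _∈J_ : Point → Frac → Set
  x ∈J (q , p) = InJ q p x

  weight-⊕ˡ : ∀ s t c → weight (s ⊕ t) c ≡ weight s c ℕ.+ weight t c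
  weight-⊕ˡ (q , p) (q′ , p′) (m , n) = distribute q p q′ p′ m n
    where
    distribute : ∀ q p q′ p′ m n →
                 (p ℕ.+ p′) ℕ.* m ℕ.+ (q ℕ.+ q′) ℕ.* n ≡
                 (p ℕ.* m ℕ.+ q ℕ.* n) ℕ.+ (p′ ℕ.* m ℕ.+ q′ ℕ.* n)
    distribute = ℕ-Solver.solve-∀

  weight-⊕ʳ : ∀ s c d → weight s (c ⊕ d) ≡ weight s c ℕ.+ weight s d
  weight-⊕ʳ (q , p) (m , n) (m′ , n′) = distribute q p m n m′ n′
    where
    distribute : ∀ q p m n m′ n′ →
                 p ℕ.* (m ℕ.+ m′) ℕ.+ q ℕ.* (n ℕ.+ n′) ≡
                 (p ℕ.* m ℕ.+ q ℕ.* n) ℕ.+ (p ℕ.* m′ ℕ.+ q ℕ.* n′)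
    distribute = ℕ-Solver.solve-∀

  size-⊕ : ∀ c d → size (c ⊕ d) ≡ size c ℕ.+ size d
  size-⊕ (m , n) (m′ , n′) = regroup m n m′ n′
    where
    regroup : ∀ m n m′ n′ → (m ℕ.+ m′) ℕ.+ (n ℕ.+ n′) ≡ (m ℕ.+ n) ℕ.+ (m′ ℕ.+ n′)
    regroup = ℕ-Solver.solve-∀

  scale-≤ : ∀ k {X Y} → X ℤ.≤ Y → + 2 * X + k ℤ.≤ + 2 * Y + k
  scale-≤ k X≤Y = ℤ.+-monoˡ-≤ k (ℤ.*-monoˡ-≤-nonNeg (+ 2) X≤Y)

  scale-≤⁻¹ : ∀ k {X Y} → + 2 * X + k ℤ.≤ + 2 * Y + k → X ℤ.≤ Y
  scale-≤⁻¹ k {X} {Y} le =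
    ℤ.*-cancelˡ-≤-pos X Y (+ 2)
      (subst₂ ℤ._≤_ (unshift (+ 2 * X) k) (unshift (+ 2 * Y) k) (ℤ.+-monoˡ-≤ (- k) le))
    where
    unshift : ∀ Z k → Z + k - k ≡ Z
    unshift = solve-∀

  cast-weight : ∀ q p m n → + (p ℕ.* m ℕ.+ q ℕ.* n) ≡ + p * + m + + q * + n
  cast-weight q p m n = cong₂ _+_ (ℤ.pos-* p m) (ℤ.pos-* q n)

  module InJ-identities where
    lower : ∀ q → + 2 * + 0 + - q ≡ - q
    lower = solve-∀
    upper : ∀ q p m n → + 2 * (+ 1 + (m + n)) + (- (q + p) - + 2) ≡ (+ 2 * m - q) + (+ 2 * n - p)
    upper = solve-∀
    upper-bound : ∀ q p → + 2 * (q + p) + (- (q + p) - + 2) ≡ (p + q) - + 2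
    upper-bound = solve-∀
    cone : ∀ q p m n → + 2 * (p * m + q * n) + - (+ 2 * (q * p)) ≡ p * (+ 2 * m - q) + q * (+ 2 * n - p)
    cone = solve-∀
    cone-apex : ∀ q p → + 2 * (q * p) + - (+ 2 * (q * p)) ≡ + 0
    cone-apex = solve-∀
    parity : ∀ m q → + 2 * m - q - q ≡ (m - q) * + 2
    parity = solve-∀
    halve : ∀ α q k → α - q ≡ k * + 2 → α ≡ + 2 * (k + q) - q
    halve α q k α-q≡2k = trans (add-back α q) (trans (cong (_+ q) α-q≡2k) (double k q))
      where
      add-back : ∀ α q → α ≡ α - q + q
      add-back = solve-∀
      double : ∀ k q → k * + 2 + q ≡ + 2 * (k + q) - q
      double = solve-∀

  InJᶜ⇒InJ : ∀ s c → InJᶜ s c → toPoint s c ∈J s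
  InJᶜ⇒InJ (q , p) (m , n) (size< , area≤) = even q m , even p n , lower q m , lower p n , upper , cone
    where
    open InJ-identities using (parity; upper-bound; cone-apex)
    even : ∀ q m → + 2 ∣ coord q m - + q
    even q m = ∣⇒∣ᵤ (divides (+ m - + q) (parity (+ m) (+ q)))
    lower : ∀ q m → - + q ℤ.≤ coord q m
    lower q m = subst (ℤ._≤ coord q m) (InJ-identities.lower (+ q)) (scale-≤ (- + q) {Y = + m} (+≤+ z≤n))
    upper : coord q m + coord p n ℤ.≤ (+ p + + q) - + 2
    upper = subst₂ ℤ._≤_ (InJ-identities.upper (+ q) (+ p) (+ m) (+ n)) (upper-bound (+ q) (+ p))
              (scale-≤ (- (+ q + + p) - + 2) (+≤+ size<))
    cone : + 0 ℤ.≤ + p * coord q m + + q * coord p n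
    cone = subst₂ ℤ._≤_ (cone-apex (+ q) (+ p)) (InJ-identities.cone (+ q) (+ p) (+ m) (+ n))
             (scale-≤ (- (+ 2 * (+ q * + p)))
               (subst₂ ℤ._≤_ (ℤ.pos-* q p) (cast-weight q p m n) (+≤+ area≤)))

  coord-surjective : ∀ q {α} → + 2 ∣ α - + q → - + q ℤ.≤ α → ∃[ m ] α ≡ coord q m
  coord-surjective q {α} 2∣α-q -q≤α with ∣ᵤ⇒∣ 2∣α-q
  ... | divides k α-q≡2k =
    ℤ.∣ k + + q ∣ , trans α≡ (cong (λ t → + 2 * t - + q) (sym (ℤ.0≤i⇒+∣i∣≡i 0≤k+q)))
    where
    α≡ : α ≡ + 2 * (k + + q) - + q
    α≡ = InJ-identities.halve α (+ q) k α-q≡2k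
    0≤k+q : + 0 ℤ.≤ k + + q
    0≤k+q = scale-≤⁻¹ (- + q) (subst₂ ℤ._≤_ (sym (InJ-identities.lower (+ q))) α≡ -q≤α)

  InJ⇒InJᶜ : ∀ s x → x ∈J s → ∃[ c ] x ≡ toPoint s c × InJᶜ s c
  InJ⇒InJᶜ (q , p) (α , β) (2∣α-q , 2∣β-p , -q≤α , -p≤β , upper , cone)
    with coord-surjective q 2∣α-q -q≤α | coord-surjective p 2∣β-p -p≤β
  ... | m , refl | n , refl = (m , n) , refl , size< , area≤
    where
    open InJ-identities using (upper-bound; cone-apex)
    size< : suc (m ℕ.+ n) ℕ.≤ q ℕ.+ p
    size< = ℤ.drop‿+≤+ (scale-≤⁻¹ (- (+ q + + p) - + 2)
              (subst₂ ℤ._≤_ (sym (InJ-identities.upper (+ q) (+ p) (+ m) (+ n)))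
                            (sym (upper-bound (+ q) (+ p))) upper))
    area≤ : q ℕ.* p ℕ.≤ p ℕ.* m ℕ.+ q ℕ.* n
    area≤ = ℤ.drop‿+≤+ (subst₂ ℤ._≤_ (sym (ℤ.pos-* q p)) (sym (cast-weight q p m n))
              (scale-≤⁻¹ (- (+ 2 * (+ q * + p)))
                (subst₂ ℤ._≤_ (sym (cone-apex (+ q) (+ p)))
                              (sym (InJ-identities.cone (+ q) (+ p) (+ m) (+ n))) cone)))

  -- Λ is the image of these three steps under toPoint (0 , 0).
  data Λ-step : Frac → Set where
    stay  : Λ-step (0 , 0)
    up    : Λ-step (0 , 1)
    right : Λ-step (1 , 0)

  Λ-step-size : ∀ {c} → Λ-step c → size c ℕ.≤ 1
  Λ-step-size stay  = z≤n
  Λ-step-size up    = s≤s z≤n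
  Λ-step-size right = s≤s z≤n

  Λ-step-swap : ∀ {c} → Λ-step c → Λ-step (swap c)
  Λ-step-swap stay  = stay
  Λ-step-swap up    = right
  Λ-step-swap right = up

  hits : Point → Point → Point → ℤ
  hits w x y = ∑ 𝟙Λ (λ z → δ w ((x ⊞ y) ⊞ z))

  ev-⋆-⋆Λ : ∀ Fa Fb w → ev ((Fa ⋆ Fb) ⋆ 𝟙Λ) w ≡ ∑ Fa (λ x → ∑ Fb (λ y → hits w x y))
  ev-⋆-⋆Λ Fa Fb w =
    trans (ev≡∑δ ((Fa ⋆ Fb) ⋆ 𝟙Λ) w) (trans (∑-⋆ (Fa ⋆ Fb) 𝟙Λ (δ w)) (∑-⋆ Fa Fb _))

  ⊞-cancelˡ : ∀ v {z z′} → v ⊞ z ≡ v ⊞ z′ → z ≡ z′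
  ⊞-cancelˡ (v₁ , v₂) same =
    cong₂ _,_ (∙-cancelˡ v₁ _ _ (cong proj₁ same)) (∙-cancelˡ v₂ _ _ (cong proj₂ same))

  ev-𝟙Λ : ∀ {cz} → Λ-step cz → ev 𝟙Λ (toPoint (0 , 0) cz) ≡ + 1
  ev-𝟙Λ stay  = refl
  ev-𝟙Λ up    = refl
  ev-𝟙Λ right = refl

  hits-one : ∀ {w} x y {cz} → Λ-step cz → (x ⊞ y) ⊞ toPoint (0 , 0) cz ≡ w → hits w x y ≡ + 1
  hits-one x y {cz} cz∈Λ hit =
    trans (∑-unique 𝟙Λ _ (toPoint (0 , 0) cz) λ z _ δ≢0 →
             ⊞-cancelˡ (x ⊞ y) (trans (δ≢0⇒≡ δ≢0) (sym hit)))
          (cong₂ _*_ (ev-𝟙Λ cz∈Λ) (δ-≡ hit))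

  hits≢0⇒Λ-step : ∀ w x y → hits w x y ≢ + 0 →
                  ∃[ cz ] Λ-step cz × (x ⊞ y) ⊞ toPoint (0 , 0) cz ≡ w
  hits≢0⇒Λ-step w x y hits≢0 =
    search (v ⊞ (+ 0 , + 0) ≟ᴾ w) (v ⊞ (+ 0 , + 2) ≟ᴾ w) (v ⊞ (+ 2 , + 0) ≟ᴾ w)
    where
    v : Point
    v = x ⊞ y
    search : Dec (v ⊞ (+ 0 , + 0) ≡ w) → Dec (v ⊞ (+ 0 , + 2) ≡ w) → Dec (v ⊞ (+ 2 , + 0) ≡ w) →
             ∃[ cz ] Λ-step cz × v ⊞ toPoint (0 , 0) cz ≡ w
    search (yes hit)  _          _          = (0 , 0) , stay , hit
    search (no _)     (yes hit)  _          = (0 , 1) , up , hit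
    search (no _)     (no _)     (yes hit)  = (1 , 0) , right , hit
    search (no miss₀) (no miss₁) (no miss₂) = contradiction
      (cong₂ _+_ (cong (+ 1 *_) (δ-≢ miss₀))
        (cong₂ _+_ (cong (+ 1 *_) (δ-≢ miss₁)) (cong (λ t → + 1 * t + + 0) (δ-≢ miss₂))))
      hits≢0

module _ where
  open import Data.Integer.Base using (_+_; _-_; _*_; -_)
  open import Data.Integer.Tactic.RingSolver using (solve-∀)

  _∈Ext_ : Point → Frac → Set
  x ∈Ext (q , p) = Extremal q p x

  swapᴾ : Point → Point
  swapᴾ (α , β) = (β , α)

  InJ-swap : ∀ {q p} x → InJ q p x → InJ p q (swapᴾ x)
  InJ-swap {q} {p} (α , β) (2∣α-q , 2∣β-p , -q≤α , -p≤β , upper , cone) =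
    2∣β-p , 2∣α-q , -p≤β , -q≤α ,
    subst₂ ℤ._≤_ (ℤ.+-comm α β) (cong (_- + 2) (ℤ.+-comm (+ p) (+ q))) upper ,
    subst (ℤ._≤_ (+ 0)) (ℤ.+-comm (+ p * α) (+ q * β)) cone

  Extremal-swap : ∀ {q p} x → Extremal q p x → Extremal p q (swapᴾ x)
  Extremal-swap x (inj₁ (q≢0 , p≢0 , inj₁ x≡P₀)) =
    inj₁ (p≢0 , q≢0 , inj₂ (inj₂ (inj₁ (cong swapᴾ x≡P₀))))
  Extremal-swap x (inj₁ (q≢0 , p≢0 , inj₂ (inj₁ x≡P₁))) =
    inj₁ (p≢0 , q≢0 , inj₂ (inj₂ (inj₂ (cong swapᴾ x≡P₁))))
  Extremal-swap x (inj₁ (q≢0 , p≢0 , inj₂ (inj₂ (inj₁ x≡Q₀)))) =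
    inj₁ (p≢0 , q≢0 , inj₁ (cong swapᴾ x≡Q₀))
  Extremal-swap x (inj₁ (q≢0 , p≢0 , inj₂ (inj₂ (inj₂ x≡Q₁)))) =
    inj₁ (p≢0 , q≢0 , inj₂ (inj₁ (cong swapᴾ x≡Q₁)))
  Extremal-swap x (inj₂ (inj₁ q≡0 , x∈J)) = inj₂ (inj₂ q≡0 , InJ-swap x x∈J)
  Extremal-swap x (inj₂ (inj₂ p≡0 , x∈J)) = inj₂ (inj₁ p≡0 , InJ-swap x x∈J)

  P₀≡toPoint : ∀ q p → P q p (+ 0) ≡ toPoint (q , p) (q , 0)
  P₀≡toPoint q p = cong₂ _,_ (first (+ q)) (second (+ p))
    where
    first : ∀ q → q + + 2 * + 0 ≡ + 2 * q - q
    first = solve-∀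
    second : ∀ p → - p ≡ + 2 * + 0 - p
    second = solve-∀

  P₁≡toPoint : ∀ q p {k} → suc k ≡ q ℕ.+ p → P q p (+ p - + 1) ≡ toPoint (q , p) (k , 0)
  P₁≡toPoint q p {k} k+1≡q+p =
    cong₂ _,_ (trans (first (+ q) (+ p)) (cong (λ t → + 2 * (t - + 1) - + q) (cong +_ (sym k+1≡q+p))))
              (second (+ p))
    where
    first : ∀ q p → q + + 2 * (p - + 1) ≡ + 2 * (q + p - + 1) - q
    first = solve-∀
    second : ∀ p → - p ≡ + 2 * + 0 - p
    second = solve-∀

  Q₀≡toPoint : ∀ q p → Q q p (+ 0) ≡ toPoint (q , p) (0 , p)
  Q₀≡toPoint q p = cong swapᴾ (P₀≡toPoint p q)

  Q₁≡toPoint : ∀ q p {k} → suc k ≡ q ℕ.+ p → Q q p (+ q - + 1) ≡ toPoint (q , p) (0 , k)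
  Q₁≡toPoint q p k+1≡q+p = cong swapᴾ (P₁≡toPoint p q (trans k+1≡q+p (ℕ.+-comm q p)))

  size-P₁ : ∀ s {k} → suc k ≡ size s → size (k , 0) ℕ.< size s
  size-P₁ s {k} k+1≡ = ℕ.≤-reflexive (trans (cong suc (ℕ.+-identityʳ k)) k+1≡)

  P₀-extremal : ∀ q p → p ≢ 0 → toPoint (q , p) (q , 0) ∈Ext (q , p)
  P₀-extremal zero    p       p≢0 =
    inj₂ (inj₁ refl , InJᶜ⇒InJ (0 , p) (0 , 0) (ℕ.n≢0⇒n>0 p≢0 , z≤n))
  P₀-extremal (suc q) zero    0≢0 = contradiction refl 0≢0
  P₀-extremal (suc q) (suc p) _   = inj₁ ((λ ()) , (λ ()) , inj₁ (sym (P₀≡toPoint (suc q) (suc p))))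

  P₁-extremal : ∀ q p {k} → suc k ≡ q ℕ.+ p → toPoint (q , p) (k , 0) ∈Ext (q , p)
  P₁-extremal zero    p       {k} k+1≡q+p =
    inj₂ (inj₁ refl , InJᶜ⇒InJ (0 , p) (k , 0) (size-P₁ (0 , p) k+1≡q+p , z≤n))
  P₁-extremal (suc q) zero    {k} k+1≡q+p =
    inj₂ (inj₂ refl , InJᶜ⇒InJ (suc q , 0) (k , 0) (size-P₁ (suc q , 0) k+1≡q+p , ℕ.≤-refl))
  P₁-extremal (suc q) (suc p) k+1≡q+p =
    inj₁ ((λ ()) , (λ ()) , inj₂ (inj₁ (sym (P₁≡toPoint (suc q) (suc p) k+1≡q+p))))

  Q₀-extremal : ∀ q p → q ≢ 0 → toPoint (q , p) (0 , p) ∈Ext (q , p)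
  Q₀-extremal q p q≢0 = Extremal-swap _ (P₀-extremal p q q≢0)

  suc-pred-+ : ∀ q p → q ≢ 0 → suc (ℕ.pred (q ℕ.+ p)) ≡ q ℕ.+ p
  suc-pred-+ zero    p 0≢0 = contradiction refl 0≢0
  suc-pred-+ (suc q) p _   = refl

  data Corner (q p : ℕ) : Frac → Set where
    P₀ : Corner q p (q , 0)
    P₁ : Corner q p (ℕ.pred (q ℕ.+ p) , 0)
    Q₀ : Corner q p (0 , p)
    Q₁ : Corner q p (0 , ℕ.pred (q ℕ.+ p))

  extremal⇒corner : ∀ {q p} x → q ≢ 0 → p ≢ 0 → x ∈Ext (q , p) →
                    ∃[ c ] Corner q p c × x ≡ toPoint (q , p) c
  extremal⇒corner {q} {p} x _   _   (inj₁ (_ , _ , inj₁ x≡P₀)) =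
    _ , P₀ , trans x≡P₀ (P₀≡toPoint q p)
  extremal⇒corner {q} {p} x q≢0 _   (inj₁ (_ , _ , inj₂ (inj₁ x≡P₁))) =
    _ , P₁ , trans x≡P₁ (P₁≡toPoint q p (suc-pred-+ q p q≢0))
  extremal⇒corner {q} {p} x _   _   (inj₁ (_ , _ , inj₂ (inj₂ (inj₁ x≡Q₀)))) =
    _ , Q₀ , trans x≡Q₀ (Q₀≡toPoint q p)
  extremal⇒corner {q} {p} x q≢0 _   (inj₁ (_ , _ , inj₂ (inj₂ (inj₂ x≡Q₁)))) =
    _ , Q₁ , trans x≡Q₁ (Q₁≡toPoint q p (suc-pred-+ q p q≢0))
  extremal⇒corner         x q≢0 _   (inj₂ (inj₁ q≡0 , _)) = contradiction q≡0 q≢0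
  extremal⇒corner         x _   p≢0 (inj₂ (inj₂ p≡0 , _)) = contradiction p≡0 p≢0

-- Farey neighbours

module _ where
  open import Data.Nat.Base
  open import Data.Nat.Properties
  open import Data.Nat.Tactic.RingSolver using (solve-∀)
  open import Data.Nat.Divisibility using (_∣_; ∣-trans; m∣m*n; n∣m*n; ∣m+n∣m⇒∣n; ∣1⇒≡1)

  size<1 : ∀ {c} → size c < 1 → c ≡ (0 , 0)
  size<1 {zero  , zero}  _        = refl
  size<1 {zero  , suc _} (s≤s ())
  size<1 {suc _ , _}     (s≤s ())

  ≤-tight : ∀ {a b x y} → a ≤ x → b ≤ y → x + y ≤ a + b → x ≡ a × y ≡ b
  ≤-tight {a} {b} {x} {y} a≤x b≤y x+y≤a+b =
    ≤-antisym (+-cancelʳ-≤ y x a (≤-trans x+y≤a+b (+-monoʳ-≤ a b≤y))) a≤x ,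
    ≤-antisym (+-cancelˡ-≤ x y b (≤-trans x+y≤a+b (+-monoˡ-≤ b a≤x))) b≤y

  record Adjacent (a b : Frac) : Set where
    constructor adjacent
    field det : proj₁ b * proj₂ a ≡ suc (proj₁ a * proj₂ b)

  adjacent-∞ : ∀ {qa pa qb} → Adjacent (qa , pa) (qb , 0) → qb ≡ 1 × pa ≡ 1
  adjacent-∞ {qa} {pa} {qb} (adjacent det) = m*n≡1⇒m≡1 qb pa qb*pa≡1 , m*n≡1⇒n≡1 qb pa qb*pa≡1
    where qb*pa≡1 = trans det (cong suc (*-zeroʳ qa))

  Adjacent-swap : ∀ {qa pa qb pb} → Adjacent (qa , pa) (qb , pb) → Adjacent (pb , qb) (pa , qa)
  Adjacent-swap {qa} {pa} {qb} {pb} (adjacent det) =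
    adjacent (trans (*-comm pa qb) (trans det (cong suc (*-comm qa pb))))

  module _ {qa pa qb pb : ℕ} (adj : Adjacent (qa , pa) (qb , pb)) where

    open Adjacent adj

    adjacent-pa≢0 : pa ≢ 0
    adjacent-pa≢0 refl = contradiction (trans (sym (*-zeroʳ qb)) det) λ ()

    adjacent-qb≢0 : qb ≢ 0
    adjacent-qb≢0 refl = contradiction det λ ()

    mediant-q≢0 : qa + qb ≢ 0
    mediant-q≢0 q≡0 = adjacent-qb≢0 (m+n≡0⇒n≡0 qa q≡0)

    mediant-p≢0 : pa + pb ≢ 0
    mediant-p≢0 p≡0 = adjacent-pa≢0 (m+n≡0⇒m≡0 pa p≡0)

    adjacent-mediantˡ : Adjacent (qa , pa) ((qa , pa) ⊕ (qb , pb))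
    adjacent-mediantˡ = adjacent (trans (*-distribʳ-+ pa qa qb) (trans (cong (_+_ (qa * pa)) det)
      (trans (+-suc (qa * pa) (qa * pb)) (cong suc (sym (*-distribˡ-+ qa pa pb))))))

    adjacent-mediantʳ : Adjacent ((qa , pa) ⊕ (qb , pb)) (qb , pb)
    adjacent-mediantʳ = adjacent (trans (*-distribˡ-+ qb pa pb)
      (trans (cong (_+ qb * pb) det) (cong suc (sym (*-distribʳ-+ pb qa qb)))))

    adjacent-coprime : Coprime qb pb
    adjacent-coprime {d} (d∣qb , d∣pb) =
      ∣1⇒≡1 (∣m+n∣m⇒∣n (subst (d ∣_) (trans det (+-comm 1 _)) (∣-trans d∣qb (m∣m*n pa)))
                       (∣-trans d∣pb (n∣m*n qa)))

    area-⊕ : area ((qa , pa) ⊕ (qb , pb)) ≡ suc ((area (qa , pa) + qa * pb) + (qa * pb + area (qb , pb)))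
    area-⊕ = begin
      (qa + qb) * (pa + pb)                     ≡⟨ expand qa qb pa pb ⟩
      qa * pa + qa * pb + qb * pa + qb * pb     ≡⟨ cong (λ t → qa * pa + qa * pb + t + qb * pb) det ⟩
      qa * pa + qa * pb + suc (qa * pb) + qb * pb ≡⟨ collect (qa * pa) (qa * pb) (qb * pb) ⟩
      suc ((qa * pa + qa * pb) + (qa * pb + qb * pb)) ∎
      where
      open ≡-Reasoning
      expand : ∀ qa qb pa pb → (qa + qb) * (pa + pb) ≡ qa * pa + qa * pb + qb * pa + qb * pb
      expand = solve-∀
      collect : ∀ A X B → A + X + suc X + B ≡ suc ((A + X) + (X + B))
      collect = solve-∀

    unimodularₘ : ∀ m n → qb * weight (qa , pa) (m , n) ≡ m + qa * weight (qb , pb) (m , n)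
    unimodularₘ m n = begin
      qb * (pa * m + qa * n)            ≡⟨ expand qb pa m qa n ⟩
      (qb * pa) * m + qa * (qb * n)     ≡⟨ cong (λ t → t * m + qa * (qb * n)) det ⟩
      suc (qa * pb) * m + qa * (qb * n) ≡⟨ collect qa pb m qb n ⟩
      m + qa * (pb * m + qb * n)        ∎
      where
      open ≡-Reasoning
      expand : ∀ qb pa m qa n → qb * (pa * m + qa * n) ≡ (qb * pa) * m + qa * (qb * n)
      expand = solve-∀
      collect : ∀ qa pb m qb n → suc (qa * pb) * m + qa * (qb * n) ≡ m + qa * (pb * m + qb * n)
      collect = solve-∀

    unimodularₙ : ∀ m n → pa * weight (qb , pb) (m , n) ≡ n + pb * weight (qa , pa) (m , n)
    unimodularₙ m n = begin
      pa * (pb * m + qb * n)            ≡⟨ expand pa pb m qb n ⟩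
      pb * (pa * m) + (qb * pa) * n     ≡⟨ cong (λ t → pb * (pa * m) + t * n) det ⟩
      pb * (pa * m) + suc (qa * pb) * n ≡⟨ collect pb pa m qa n ⟩
      n + pb * (pa * m + qa * n)        ∎
      where
      open ≡-Reasoning
      expand : ∀ pa pb m qb n → pa * (pb * m + qb * n) ≡ pb * (pa * m) + (qb * pa) * n
      expand = solve-∀
      collect : ∀ pb pa m qa n → pb * (pa * m) + suc (qa * pb) * n ≡ n + pb * (pa * m + qa * n)
      collect = solve-∀

    weight-injective : ∀ {c d} → weight (qa , pa) c ≡ weight (qa , pa) d →
                       weight (qb , pb) c ≡ weight (qb , pb) d → c ≡ d
    weight-injective {m , n} {m′ , n′} same-a same-b = cong₂ _,_
      (+-cancelʳ-≡ _ m m′ (begin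
        m + qa * weight (qb , pb) (m , n)     ≡⟨ unimodularₘ m n ⟨
        qb * weight (qa , pa) (m , n)         ≡⟨ cong (qb *_) same-a ⟩
        qb * weight (qa , pa) (m′ , n′)       ≡⟨ unimodularₘ m′ n′ ⟩
        m′ + qa * weight (qb , pb) (m′ , n′)  ≡⟨ cong (λ t → m′ + qa * t) same-b ⟨
        m′ + qa * weight (qb , pb) (m , n)    ∎))
      (+-cancelʳ-≡ _ n n′ (begin
        n + pb * weight (qa , pa) (m , n)     ≡⟨ unimodularₙ m n ⟨
        pa * weight (qb , pb) (m , n)         ≡⟨ cong (pa *_) same-b ⟩
        pa * weight (qb , pb) (m′ , n′)       ≡⟨ unimodularₙ m′ n′ ⟩
        n′ + pb * weight (qa , pa) (m′ , n′)  ≡⟨ cong (λ t → n′ + pb * t) same-a ⟨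
        n′ + pb * weight (qa , pa) (m , n)    ∎))
      where open ≡-Reasoning

    weights⇒P₀ : ∀ {c} → weight (qa , pa) c ≡ area (qa , pa) → weight (qb , pb) c ≡ qa * pb →
                 c ≡ (qa , 0)
    weights⇒P₀ wa wb = weight-injective (trans wa (at-P₀ qa pa qa)) (trans wb (at-P₀ qa pb qb))
      where
      at-P₀ : ∀ qa p q → qa * p ≡ p * qa + q * 0
      at-P₀ = solve-∀

    weights⇒Q₀ : ∀ {c} → weight (qa , pa) c ≡ qa * pb → weight (qb , pb) c ≡ area (qb , pb) →
                 c ≡ (0 , pb)
    weights⇒Q₀ wa wb = weight-injective (trans wa (at-Q₀ pa qa pb)) (trans wb (at-Q₀ pb qb pb))
      where
      at-Q₀ : ∀ p q pb → q * pb ≡ p * 0 + q * pb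
      at-Q₀ = solve-∀

    weight-bound-right : ∀ c → area (qa , pa) ≤ weight (qa , pa) c → qa * pb ≤ weight (qb , pb) c
    weight-bound-right (m , n) area≤weight = *-cancelˡ-≤ pa {{≢-nonZero adjacent-pa≢0}} (begin
      pa * (qa * pb)                    ≡⟨ rearrange pa qa pb ⟩
      pb * (qa * pa)                    ≤⟨ *-monoʳ-≤ pb area≤weight ⟩
      pb * weight (qa , pa) (m , n)     ≤⟨ m≤n+m _ n ⟩
      n + pb * weight (qa , pa) (m , n) ≡⟨ unimodularₙ m n ⟨
      pa * weight (qb , pb) (m , n)     ∎)
      where
      open ≤-Reasoning
      rearrange : ∀ pa qa pb → pa * (qa * pb) ≡ pb * (qa * pa)
      rearrange = solve-∀

    weight-bound-left : ∀ c → area (qb , pb) ≤ weight (qb , pb) c → qa * pb ≤ weight (qa , pa) c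
    weight-bound-left (m , n) area≤weight = *-cancelˡ-≤ qb {{≢-nonZero adjacent-qb≢0}} (begin
      qb * (qa * pb)                    ≡⟨ rearrange qb qa pb ⟩
      qa * (qb * pb)                    ≤⟨ *-monoʳ-≤ qa area≤weight ⟩
      qa * weight (qb , pb) (m , n)     ≤⟨ m≤n+m _ m ⟩
      m + qa * weight (qb , pb) (m , n) ≡⟨ unimodularₘ m n ⟨
      qb * weight (qa , pa) (m , n)     ∎)
      where
      open ≤-Reasoning
      rearrange : ∀ qb qa pb → qb * (qa * pb) ≡ qa * (qb * pb)
      rearrange = solve-∀

-- Decompositions of points of J_a + J_b + Λ

  record Decomposition (a b c : Frac) : Set where
    constructor decomposition
    field
      {cx cy cz} : Frac
      cx∈J : InJᶜ a cx
      cy∈J : InJᶜ b cy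
      cz∈Λ : Λ-step cz
      sum  : (cx ⊕ cy) ⊕ cz ≡ c

  InJᶜ-swap : ∀ s c → InJᶜ s c → InJᶜ (swap s) (swap c)
  InJᶜ-swap (q , p) (m , n) (size< , area≤) =
    subst₂ _<_ (+-comm m n) (+-comm q p) size< , subst₂ _≤_ (*-comm q p) (+-comm (p * m) (q * n)) area≤

  Decomposition-swap : ∀ {a b c} → Decomposition a b c → Decomposition (swap b) (swap a) (swap c)
  Decomposition-swap {a} {b} (decomposition {mx , nx} {my , ny} {mz , nz} cx∈J cy∈J cz∈Λ sum) =
    decomposition (InJᶜ-swap b (my , ny) cy∈J) (InJᶜ-swap a (mx , nx) cx∈J) (Λ-step-swap cz∈Λ)
      (cong₂ _,_ (trans (cong (_+ nz) (+-comm ny nx)) (,-injectiveʳ sum))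
                 (trans (cong (_+ mz) (+-comm my mx)) (,-injectiveˡ sum)))

  Decomposition-size : ∀ {a b c} → Decomposition a b c → size c < size (a ⊕ b)
  Decomposition-size {a} {b} (decomposition {cx} {cy} {cz} (sizeˣ , _) (sizeʸ , _) cz∈Λ refl) = begin-strict
    size ((cx ⊕ cy) ⊕ cz)          ≡⟨ trans (size-⊕ (cx ⊕ cy) cz) (cong (_+ size cz) (size-⊕ cx cy)) ⟩
    (size cx + size cy) + size cz  ≡⟨ +-assoc (size cx) (size cy) (size cz) ⟩
    size cx + (size cy + size cz)  <⟨ +-monoˡ-< _ sizeˣ ⟩
    size a + (size cy + size cz)   ≤⟨ +-monoʳ-≤ (size a) (+-monoʳ-≤ (size cy) (Λ-step-size cz∈Λ)) ⟩
    size a + (size cy + 1)         ≡⟨ cong (_+_ (size a)) (+-comm (size cy) 1) ⟩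
    size a + suc (size cy)         ≤⟨ +-monoʳ-≤ (size a) sizeʸ ⟩
    size a + size b                ≡⟨ size-⊕ a b ⟨
    size (a ⊕ b)                   ∎
    where open ≤-Reasoning

  Λ-step-weight : ∀ {s cz} → Λ-step cz → weight s cz ≡ 0 → proj₁ s ≢ 0 → proj₂ s ≢ 0 →
                  cz ≡ (0 , 0)
  Λ-step-weight         stay  _   _   _   = refl
  Λ-step-weight {q , p} up    w≡0 q≢0 _   = contradiction (trans (weight-up q p) w≡0) q≢0
    where
    weight-up : ∀ q p → q ≡ p * 0 + q * 1
    weight-up = solve-∀
  Λ-step-weight {q , p} right w≡0 _   p≢0 = contradiction (trans (weight-right q p) w≡0) p≢0
    where
    weight-right : ∀ q p → p ≡ p * 1 + q * 0
    weight-right = solve-∀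

  m+n+o≡0⇒ : ∀ {x y z} → (x + y) + z ≡ 0 → x ≡ 0 × y ≡ 0 × z ≡ 0
  m+n+o≡0⇒ {x} {y} sum≡0 =
    m+n≡0⇒m≡0 x x+y≡0 , m+n≡0⇒n≡0 x x+y≡0 , m+n≡0⇒n≡0 (x + y) sum≡0
    where x+y≡0 = m+n≡0⇒m≡0 (x + y) sum≡0

  axis-bound : ∀ q p m → p ≢ 0 → q * p ≤ p * m + q * 0 → q ≤ m
  axis-bound q p m p≢0 area≤ =
    *-cancelˡ-≤ p {{≢-nonZero p≢0}}
      (subst₂ _≤_ (*-comm q p) (trans (cong (_+_ (p * m)) (*-zeroʳ q)) (+-identityʳ _)) area≤)

  P₁-unique : ∀ {a b ka kb k} → suc ka ≡ size a → suc kb ≡ size b → suc k ≡ size a + size b →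
              (d : Decomposition a b (k , 0)) → Decomposition.cx d ≡ (ka , 0) × Decomposition.cy d ≡ (kb , 0)
  P₁-unique {a} {b} {ka} {kb} {k} size-a≡ size-b≡ size-ab≡
            (decomposition {mx , nx} {my , ny} {mz , nz} (sizeˣ , _) (sizeʸ , _) cz∈Λ sum)
    with m+n+o≡0⇒ {nx} {ny} {nz} (,-injectiveʳ sum)
  ... | refl , refl , refl = cong (_, 0) (sym (proj₁ tight)) , cong (_, 0) (sym (proj₂ tight))
    where
    mx≤ka : mx ≤ ka
    mx≤ka = ≤-pred (subst₂ _≤_ (cong suc (+-identityʳ mx)) (sym size-a≡) sizeˣ)
    my≤kb : my ≤ kb
    my≤kb = ≤-pred (subst₂ _≤_ (cong suc (+-identityʳ my)) (sym size-b≡) sizeʸ)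
    mz≤1 : mz ≤ 1
    mz≤1 = subst (_≤ 1) (+-identityʳ mz) (Λ-step-size cz∈Λ)
    k≡ : (ka + kb) + 1 ≡ k
    k≡ = suc-injective (trans (cong suc (trans (+-assoc ka kb 1) (cong (_+_ ka) (+-comm kb 1))))
                              (trans (cong₂ _+_ size-a≡ size-b≡) (sym size-ab≡)))
    total : (ka + kb) + 1 ≤ (mx + my) + mz
    total = ≤-reflexive (trans k≡ (sym (,-injectiveˡ sum)))
    tight = ≤-tight mx≤ka my≤kb (≤-reflexive (proj₁ (≤-tight (+-mono-≤ mx≤ka my≤kb) mz≤1 total)))

  P₀-unique-∞ : ∀ {qa pa qb} → Adjacent (qa , pa) (qb , 0) →
                (d : Decomposition (qa , pa) (qb , 0) (qa + qb , 0)) →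
                Decomposition.cx d ≡ (qa , 0) × Decomposition.cy d ≡ (0 , 0)
  P₀-unique-∞ {qa} {pa} {qb} adj
              (decomposition {mx , nx} {my , ny} {mz , nz} (sizeˣ , areaˣ) (sizeʸ , _) _ sum)
    with adjacent-∞ adj
  ... | refl , refl with size<1 {my , ny} sizeʸ
  ... | refl with m+n+o≡0⇒ {nx} {0} {nz} (,-injectiveʳ sum)
  ... | refl , _ , _ = cong (_, 0) (≤-antisym mx≤qa qa≤mx) , refl
    where
    mx≤qa : mx ≤ qa
    mx≤qa = ≤-pred (subst₂ _≤_ (cong suc (+-identityʳ mx)) (+-comm qa 1) sizeˣ)
    qa≤mx : qa ≤ mx
    qa≤mx = axis-bound qa 1 mx (λ ()) areaˣ

  module _ {qa pa qb pb : ℕ} (adj : Adjacent (qa , pa) (qb , pb)) where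

    open Adjacent adj

    P₀-unique : pb ≢ 0 → (d : Decomposition (qa , pa) (qb , pb) (qa + qb , 0)) →
                Decomposition.cx d ≡ (qa , 0) × Decomposition.cy d ≡ (qb , 0)
    P₀-unique pb≢0 (decomposition {mx , nx} {my , ny} {mz , nz} (_ , areaˣ) (_ , areaʸ) _ sum)
      with m+n+o≡0⇒ {nx} {ny} {nz} (,-injectiveʳ sum)
    ... | refl , refl , refl = cong (_, 0) (proj₁ tight) , cong (_, 0) (proj₂ tight)
      where
      qa≤mx : qa ≤ mx
      qa≤mx = axis-bound qa pa mx (adjacent-pa≢0 adj) areaˣ
      qb≤my : qb ≤ my
      qb≤my = axis-bound qb pb my pb≢0 areaʸ
      mz≡0 = ≤-tight (+-mono-≤ qa≤mx qb≤my) z≤n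
               (≤-reflexive (trans (,-injectiveˡ sum) (sym (+-identityʳ _))))
      tight = ≤-tight qa≤mx qb≤my (≤-reflexive (proj₁ mz≡0))

    escape-unique : ∀ {c} (d : Decomposition (qa , pa) (qb , pb) c) →
                    weight ((qa , pa) ⊕ (qb , pb)) c < area ((qa , pa) ⊕ (qb , pb)) →
                    Decomposition.cx d ≡ (qa , 0) × Decomposition.cy d ≡ (0 , pb) ×
                    Decomposition.cz d ≡ (0 , 0)
    escape-unique (decomposition {cx} {cy} {cz} (_ , areaˣ) (_ , areaʸ) cz∈Λ refl) W<area =
      weights⇒P₀ adj (proj₁ x-tight) (proj₂ x-tight) ,
      weights⇒Q₀ adj (proj₁ y-tight) (proj₂ y-tight) ,
      Λ-step-weight {(qa , pa) ⊕ (qb , pb)} cz∈Λ (proj₂ outer) (mediant-q≢0 adj) (mediant-p≢0 adj)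
      where
      a b : Frac
      a = (qa , pa)
      b = (qb , pb)
      boundʳ : qa * pb ≤ weight b cx
      boundʳ = weight-bound-right adj cx areaˣ
      boundˡ : qa * pb ≤ weight a cy
      boundˡ = weight-bound-left adj cy areaʸ
      split : weight (a ⊕ b) ((cx ⊕ cy) ⊕ cz) ≡
              ((weight a cx + weight b cx) + (weight a cy + weight b cy)) + weight (a ⊕ b) cz
      split = trans (weight-⊕ʳ (a ⊕ b) (cx ⊕ cy) cz) (cong (_+ weight (a ⊕ b) cz)
                (trans (weight-⊕ʳ (a ⊕ b) cx cy) (cong₂ _+_ (weight-⊕ˡ a b cx) (weight-⊕ˡ a b cy))))
      outer = ≤-tight (+-mono-≤ (+-mono-≤ areaˣ boundʳ) (+-mono-≤ boundˡ areaʸ)) z≤n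
                (≤-pred (subst₂ _<_ split (trans (area-⊕ adj) (cong suc (sym (+-identityʳ _)))) W<area))
      inner = ≤-tight (+-mono-≤ areaˣ boundʳ) (+-mono-≤ boundˡ areaʸ) (≤-reflexive (proj₁ outer))
      x-tight = ≤-tight areaˣ boundʳ (≤-reflexive (proj₁ inner))
      y-tight = ≤-tight boundˡ areaʸ (≤-reflexive (proj₂ inner))

    area-left-child : area ((qa , pa) ⊕ ((qa , pa) ⊕ (qb , pb))) ≡
                      suc ((qa * pb + (qa * pb + area (qb , pb))) +
                           weight ((qa , pa) ⊕ ((qa , pa) ⊕ (qb , pb))) (qa , pa))
    area-left-child = begin
      (qa + (qa + qb)) * (pa + (pa + pb)) ≡⟨ expand qa pa qb pb ⟩
      qb * pa + R                         ≡⟨ cong (_+ R) det ⟩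
      suc (qa * pb) + R                   ≡⟨ collect qa pa qb pb ⟩
      suc ((qa * pb + (qa * pb + qb * pb)) + ((pa + (pa + pb)) * qa + (qa + (qa + qb)) * pa)) ∎
      where
      open ≡-Reasoning
      R : ℕ
      R = 4 * (qa * pa) + 2 * (qa * pb) + qb * pa + qb * pb
      expand : ∀ qa pa qb pb →
               (qa + (qa + qb)) * (pa + (pa + pb)) ≡ qb * pa + (4 * (qa * pa) + 2 * (qa * pb) + qb * pa + qb * pb)
      expand = solve-∀
      collect : ∀ qa pa qb pb → suc (qa * pb) + (4 * (qa * pa) + 2 * (qa * pb) + qb * pa + qb * pb) ≡
                suc ((qa * pb + (qa * pb + qb * pb)) + ((pa + (pa + pb)) * qa + (qa + (qa + qb)) * pa))
      collect = solve-∀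

    left-child-escape : ∀ c → InJᶜ (qb , pb) c →
                        weight ((qa , pa) ⊕ ((qa , pa) ⊕ (qb , pb))) (c ⊕ (qa , pa)) <
                        area ((qa , pa) ⊕ ((qa , pa) ⊕ (qb , pb))) → c ≡ (0 , pb)
    left-child-escape c (_ , area≤) W<area = weights⇒Q₀ adj (proj₁ tight′) (proj₂ tight′)
      where
      a b s : Frac
      a = (qa , pa)
      b = (qb , pb)
      s = a ⊕ (a ⊕ b)
      K : ℕ
      K = weight s a
      bound : qa * pb ≤ weight a c
      bound = weight-bound-left adj c area≤
      split : weight s (c ⊕ a) ≡ (weight a c + (weight a c + weight b c)) + K
      split = trans (weight-⊕ʳ s c a)
                (cong (_+ K) (trans (weight-⊕ˡ a (a ⊕ b) c) (cong (_+_ (weight a c)) (weight-⊕ˡ a b c))))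
      tight = ≤-tight bound (+-mono-≤ bound area≤)
                (+-cancelʳ-≤ K _ _ (≤-pred (subst₂ _<_ split area-left-child W<area)))
      tight′ = ≤-tight bound area≤ (≤-reflexive (proj₂ tight))

    left-child-axis : ∀ m n → InJᶜ (qb , pb) (m , n) → m + qa ≡ 0 → n + pa < pa + (pa + pb)
    left-child-axis m n (size< , _) m+qa≡0 with m+n≡0⇒m≡0 m m+qa≡0 | m+n≡0⇒n≡0 m m+qa≡0
    ... | refl | refl with m*n≡1⇒m≡1 qb pa det | m*n≡1⇒n≡1 qb pa det
    ... | refl | refl = s≤s (subst (_≤ suc pb) (+-comm 1 n) (s≤s (≤-pred size<)))

-- The vertex opposite a child in its Farey triangle

  record OppositeVertex (s′ s : Frac) (u : Point) : Set where
    field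
      covered         : ∀ x → x ∈J s′ → x ∈J s ⊎ x ≡ u
      u-extremal      : u ∈Ext s′
      avoids-extremal : ∀ x → x ∈J s′ → ¬ x ∈Ext s

  OppositeVertex-swap : ∀ {s′ s u} → OppositeVertex s′ s u → OppositeVertex (swap s′) (swap s) (swapᴾ u)
  OppositeVertex-swap {u = u} opposite = record
    { covered         = λ x x∈J →
        Sum.map (InJ-swap (swapᴾ x)) (cong swapᴾ) (covered (swapᴾ x) (InJ-swap x x∈J))
    ; u-extremal      = Extremal-swap u u-extremal
    ; avoids-extremal = λ x x∈J x∈Ext →
        avoids-extremal (swapᴾ x) (InJ-swap x x∈J) (Extremal-swap x x∈Ext)
    }
    where open OppositeVertex opposite

  size-shift : ∀ a s′ c → size c < size s′ → size (c ⊕ a) < size (a ⊕ (a ⊕ s′))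
  size-shift (qa , pa) (q′ , p′) (m , n) size< = begin-strict
    (m + qa) + (n + pa)                  ≡⟨ regroup m n qa pa ⟩
    (m + n) + (qa + pa)                  <⟨ +-monoˡ-< (qa + pa) size< ⟩
    (q′ + p′) + (qa + pa)                ≤⟨ m≤n+m _ (qa + pa) ⟩
    (qa + pa) + ((q′ + p′) + (qa + pa))  ≡⟨ regroup′ qa pa q′ p′ ⟩
    (qa + (qa + q′)) + (pa + (pa + p′))  ∎
    where
    open ≤-Reasoning
    regroup : ∀ m n qa pa → (m + qa) + (n + pa) ≡ (m + n) + (qa + pa)
    regroup = solve-∀
    regroup′ : ∀ qa pa q′ p′ →
               (qa + pa) + ((q′ + p′) + (qa + pa)) ≡ (qa + (qa + q′)) + (pa + (pa + p′))
    regroup′ = solve-∀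

  module _ {qa pa q′ p′ : ℕ} (adj : Adjacent (qa , pa) (q′ , p′)) where

    private
      a s′ s : Frac
      a  = (qa , pa)
      s′ = (q′ , p′)
      s  = a ⊕ (a ⊕ s′)
      u : Point
      u  = toPoint s (qa , pa + p′)

      q≢0 : qa + (qa + q′) ≢ 0
      q≢0 = mediant-q≢0 (adjacent-mediantˡ adj)

      u≡Q₀′ : u ≡ toPoint s′ (0 , p′)
      u≡Q₀′ = trans (cong (λ t → toPoint s (qa , t)) (+-comm pa p′)) (toPoint-shift a s′ (0 , p′))

    left-child-covered : ∀ x → x ∈J s′ → x ∈J s ⊎ x ≡ u
    left-child-covered x x∈J with InJ⇒InJᶜ s′ x x∈J
    ... | c , refl , c∈J with area s ≤? weight s (c ⊕ a)
    ...   | yes area≤ =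
      inj₁ (subst (_∈J s) (toPoint-shift a s′ c)
                  (InJᶜ⇒InJ s (c ⊕ a) (size-shift a s′ c (proj₁ c∈J) , area≤)))
    ...   | no  area≰ =
      inj₂ (trans (cong (toPoint s′) (left-child-escape adj c c∈J (≰⇒> area≰))) (sym u≡Q₀′))

    left-child-avoids-extremal : ∀ x → x ∈J s′ → ¬ x ∈Ext s
    left-child-avoids-extremal x x∈J x∈Ext with InJ⇒InJᶜ s′ x x∈J
    ... | (m , n) , refl , c∈J with extremal⇒corner _ q≢0 (mediant-p≢0 (adjacent-mediantˡ adj)) x∈Ext
    ...   | c , corner , x≡ = excluded corner (toPoint-injective s (trans (toPoint-shift a s′ (m , n)) x≡))
      where
      p≤k : pa + (pa + p′) ≤ pred ((qa + (qa + q′)) + (pa + (pa + p′)))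
      p≤k = ≤-pred (subst (suc (pa + (pa + p′)) ≤_) (sym (suc-pred-+ _ _ q≢0))
                      (+-monoˡ-≤ (pa + (pa + p′)) (n≢0⇒n>0 q≢0)))
      excluded : ∀ {c} → Corner (qa + (qa + q′)) (pa + (pa + p′)) c → (m + qa , n + pa) ≡ c → ⊥
      excluded P₀ same = adjacent-pa≢0 adj (m+n≡0⇒n≡0 n (,-injectiveʳ same))
      excluded P₁ same = adjacent-pa≢0 adj (m+n≡0⇒n≡0 n (,-injectiveʳ same))
      excluded Q₀ same = <-irrefl (,-injectiveʳ same) (left-child-axis adj m n c∈J (,-injectiveˡ same))
      excluded Q₁ same =
        <-irrefl (,-injectiveʳ same) (<-≤-trans (left-child-axis adj m n c∈J (,-injectiveˡ same)) p≤k)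

    opposite-of-left-child : OppositeVertex s′ s u
    opposite-of-left-child = record
      { covered         = left-child-covered
      ; u-extremal      = subst (_∈Ext s′) (sym u≡Q₀′) (Q₀-extremal q′ p′ (adjacent-qb≢0 adj))
      ; avoids-extremal = left-child-avoids-extremal
      }

  -- The mirror image (q , p) ↦ (p , q) of a right child is a left child.
  opposite-of-right-child : ∀ {q′ p′ qb pb} → Adjacent (q′ , p′) (qb , pb) →
    OppositeVertex (q′ , p′) (((q′ , p′) ⊕ (qb , pb)) ⊕ (qb , pb))
                   (toPoint (((q′ , p′) ⊕ (qb , pb)) ⊕ (qb , pb)) (q′ + qb , pb))
  opposite-of-right-child {q′} {p′} {qb} {pb} adj =
    subst₂ (OppositeVertex (q′ , p′)) s≡ (cong₂ toPoint s≡ (cong (_, pb) (+-comm qb q′)))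
      (OppositeVertex-swap (opposite-of-left-child (Adjacent-swap adj)))
    where
    regroup : ∀ b x → b + (b + x) ≡ (x + b) + b
    regroup = solve-∀
    s≡ : (qb + (qb + q′) , pb + (pb + p′)) ≡ ((q′ + qb) + qb , (p′ + pb) + pb)
    s≡ = cong₂ _,_ (regroup qb q′) (regroup pb p′)

module _ where
  open import Data.Integer.Base using (_-_; _*_)

  record Shaped (s : Frac) (F : FS) : Set where
    constructor shaped
    field
      support  : ∀ x → ev F x ≢ + 0 → x ∈J s
      extremal : ∀ x → x ∈Ext s → ev F x ≡ + 1

  record UniqueDecomposition (a b c : Frac) : Set where
    field
      {x₀ y₀ z₀}  : Frac
      x₀-extremal : toPoint a x₀ ∈Ext a
      y₀-extremal : toPoint b y₀ ∈Ext b
      z₀∈Λ        : Λ-step z₀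
      sum         : (x₀ ⊕ y₀) ⊕ z₀ ≡ c
      unique      : (d : Decomposition a b c) → Decomposition.cx d ≡ x₀ × Decomposition.cy d ≡ y₀

  UniqueDecomposition-swap : ∀ {a b c} → UniqueDecomposition a b c →
                             UniqueDecomposition (swap b) (swap a) (swap c)
  UniqueDecomposition-swap {a} {b} ud = record
    { x₀-extremal = Extremal-swap (toPoint b y₀) y₀-extremal
    ; y₀-extremal = Extremal-swap (toPoint a x₀) x₀-extremal
    ; z₀∈Λ        = Λ-step-swap z₀∈Λ
    ; sum         = cong₂ _,_
        (trans (cong (ℕ._+ proj₂ z₀) (ℕ.+-comm (proj₂ y₀) (proj₂ x₀))) (,-injectiveʳ sum))
        (trans (cong (ℕ._+ proj₁ z₀) (ℕ.+-comm (proj₁ y₀) (proj₁ x₀))) (,-injectiveˡ sum))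
    ; unique      = λ d → let cx≡ , cy≡ = unique (Decomposition-swap d) in cong swap cy≡ , cong swap cx≡
    }
    where open UniqueDecomposition ud

  escape-corner : ∀ {qa pa qb pb} → Adjacent (qa , pa) (qb , pb) →
                  ¬ InJᶜ ((qa , pa) ⊕ (qb , pb)) (qa , pb) → UniqueDecomposition (qa , pa) (qb , pb) (qa , pb)
  escape-corner {qa} {pa} {qb} {pb} adj u∉J = record
    { x₀ = (qa , 0) ; y₀ = (0 , pb) ; z₀ = (0 , 0)
    ; x₀-extremal = P₀-extremal qa pa (adjacent-pa≢0 adj)
    ; y₀-extremal = Q₀-extremal qb pb (adjacent-qb≢0 adj)
    ; z₀∈Λ        = stay
    ; sum         = cong₂ _,_ (trans (ℕ.+-identityʳ _) (ℕ.+-identityʳ qa)) (ℕ.+-identityʳ pb)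
    ; unique      = λ d →
        let cx≡ , cy≡ , _ = escape-unique adj d (ℕ.≰⇒> λ area≤ → u∉J (Decomposition-size d , area≤))
        in cx≡ , cy≡
    }

  P₀-corner : ∀ {qa pa qb} pb → Adjacent (qa , pa) (qb , pb) →
              UniqueDecomposition (qa , pa) (qb , pb) (qa ℕ.+ qb , 0)
  P₀-corner {qa} {pa} {qb} zero adj = record
    { x₀ = (qa , 0) ; y₀ = (0 , 0) ; z₀ = (1 , 0)
    ; x₀-extremal = P₀-extremal qa pa (adjacent-pa≢0 adj)
    ; y₀-extremal = Q₀-extremal qb 0 (adjacent-qb≢0 adj)
    ; z₀∈Λ        = right
    ; sum         = cong (_, 0) (trans (cong (ℕ._+ 1) (ℕ.+-identityʳ qa))
                                       (cong (qa ℕ.+_) (sym (proj₁ (adjacent-∞ adj)))))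
    ; unique      = P₀-unique-∞ adj
    }
  P₀-corner {qa} {pa} {qb} (suc pb) adj = record
    { x₀ = (qa , 0) ; y₀ = (qb , 0) ; z₀ = (0 , 0)
    ; x₀-extremal = P₀-extremal qa pa (adjacent-pa≢0 adj)
    ; y₀-extremal = P₀-extremal qb (suc pb) (λ ())
    ; z₀∈Λ        = stay
    ; sum         = cong (_, 0) (ℕ.+-identityʳ _)
    ; unique      = P₀-unique adj (λ ())
    }

  Q₀-corner : ∀ {pa qb pb} qa → Adjacent (qa , pa) (qb , pb) →
              UniqueDecomposition (qa , pa) (qb , pb) (0 , pa ℕ.+ pb)
  Q₀-corner {pa} {qb} {pb} qa adj =
    subst (UniqueDecomposition (qa , pa) (qb , pb)) (cong (0 ,_) (ℕ.+-comm pb pa))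
      (UniqueDecomposition-swap (P₀-corner qa (Adjacent-swap adj)))

  P₁-corner : ∀ {qa pa qb pb} → Adjacent (qa , pa) (qb , pb) →
              UniqueDecomposition (qa , pa) (qb , pb) (ℕ.pred ((qa ℕ.+ qb) ℕ.+ (pa ℕ.+ pb)) , 0)
  P₁-corner {qa} {pa} {qb} {pb} adj = record
    { x₀ = (ka , 0) ; y₀ = (kb , 0) ; z₀ = (1 , 0)
    ; x₀-extremal = P₁-extremal qa pa size-a≡
    ; y₀-extremal = P₁-extremal qb pb size-b≡
    ; z₀∈Λ        = right
    ; sum         = cong (_, 0) (ℕ.suc-injective
                      (trans (regroup ka kb) (trans (cong₂ ℕ._+_ size-a≡ size-b≡) (sym size-s≡))))
    ; unique      = P₁-unique size-a≡ size-b≡ size-s≡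
    }
    where
    ka kb : ℕ
    ka = ℕ.pred (qa ℕ.+ pa)
    kb = ℕ.pred (qb ℕ.+ pb)
    size-a≡ : suc ka ≡ qa ℕ.+ pa
    size-a≡ = trans (cong (λ t → suc (ℕ.pred t)) (ℕ.+-comm qa pa))
                    (trans (suc-pred-+ pa qa (adjacent-pa≢0 adj)) (ℕ.+-comm pa qa))
    size-b≡ : suc kb ≡ qb ℕ.+ pb
    size-b≡ = suc-pred-+ qb pb (adjacent-qb≢0 adj)
    shuffle : ∀ qa qb pa pb → (qa ℕ.+ qb) ℕ.+ (pa ℕ.+ pb) ≡ (qa ℕ.+ pa) ℕ.+ (qb ℕ.+ pb)
    shuffle = ℕ-Solver.solve-∀
    size-s≡ : suc (ℕ.pred ((qa ℕ.+ qb) ℕ.+ (pa ℕ.+ pb))) ≡ (qa ℕ.+ pa) ℕ.+ (qb ℕ.+ pb)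
    size-s≡ = trans (suc-pred-+ (qa ℕ.+ qb) (pa ℕ.+ pb) (mediant-q≢0 adj)) (shuffle qa qb pa pb)
    regroup : ∀ ka kb → suc ((ka ℕ.+ kb) ℕ.+ 1) ≡ suc ka ℕ.+ suc kb
    regroup = ℕ-Solver.solve-∀

  Q₁-corner : ∀ {qa pa qb pb} → Adjacent (qa , pa) (qb , pb) →
              UniqueDecomposition (qa , pa) (qb , pb) (0 , ℕ.pred ((qa ℕ.+ qb) ℕ.+ (pa ℕ.+ pb)))
  Q₁-corner {qa} {pa} {qb} {pb} adj =
    subst (UniqueDecomposition (qa , pa) (qb , pb)) (cong (λ t → (0 , ℕ.pred t)) (shuffle qa qb pa pb))
      (UniqueDecomposition-swap (P₁-corner (Adjacent-swap adj)))
    where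
    shuffle : ∀ qa qb pa pb → (pb ℕ.+ pa) ℕ.+ (qb ℕ.+ qa) ≡ (qa ℕ.+ qb) ℕ.+ (pa ℕ.+ pb)
    shuffle = ℕ-Solver.solve-∀

  module _ {a b : Frac} {Fa Fb : FS} (shaped-a : Shaped a Fa) (shaped-b : Shaped b Fb) where

    decompose : ∀ w x y → ev Fa x ≢ + 0 → ev Fb y ≢ + 0 → hits w x y ≢ + 0 →
                ∃[ c ] Σ (Decomposition a b c) λ d →
                  x ≡ toPoint a (Decomposition.cx d) × y ≡ toPoint b (Decomposition.cy d) ×
                  w ≡ toPoint (a ⊕ b) c
    decompose w x y evx≢0 evy≢0 hits≢0
      with InJ⇒InJᶜ a x (Shaped.support shaped-a x evx≢0) | InJ⇒InJᶜ b y (Shaped.support shaped-b y evy≢0)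
         | hits≢0⇒Λ-step w x y hits≢0
    ... | cx , refl , cx∈J | cy , refl , cy∈J | cz , cz∈Λ , hit =
      _ , decomposition cx∈J cy∈J cz∈Λ refl , refl , refl ,
      sym (trans (toPoint-translate (a ⊕ b) (cx ⊕ cy) cz)
                 (trans (cong (_⊞ toPoint (0 , 0) cz) (toPoint-⊕ a b cx cy)) hit))

    ev-⋆-⋆Λ-vanishes : ∀ w → (∀ c → Decomposition a b c → w ≢ toPoint (a ⊕ b) c) →
                       ev ((Fa ⋆ Fb) ⋆ 𝟙Λ) w ≡ + 0
    ev-⋆-⋆Λ-vanishes w unreachable = trans (ev-⋆-⋆Λ Fa Fb w) (∑∑-vanishes Fa Fb (hits w) vanish)
      where
      vanish : ∀ x y → ev Fa x ≢ + 0 → ev Fb y ≢ + 0 → hits w x y ≡ + 0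
      vanish x y evx≢0 evy≢0 with hits w x y ℤ.≟ + 0
      ... | yes hits≡0 = hits≡0
      ... | no  hits≢0 =
        let c , d , _ , _ , w≡ = decompose w x y evx≢0 evy≢0 hits≢0 in contradiction w≡ (unreachable c d)

    ev-⋆-⋆Λ-unique : ∀ {c} → UniqueDecomposition a b c → ev ((Fa ⋆ Fb) ⋆ 𝟙Λ) (toPoint (a ⊕ b) c) ≡ + 1
    ev-⋆-⋆Λ-unique {c} ud = begin
      ev ((Fa ⋆ Fb) ⋆ 𝟙Λ) w                     ≡⟨ ev-⋆-⋆Λ Fa Fb w ⟩
      ∑ Fa (λ x → ∑ Fb (hits w x))              ≡⟨ ∑∑-unique Fa Fb (hits w) x₀′ y₀′ only ⟩
      ev Fa x₀′ * (ev Fb y₀′ * hits w x₀′ y₀′)  ≡⟨ cong₂ _*_ (Shaped.extremal shaped-a x₀′ x₀-extremal)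
                                                     (cong₂ _*_ (Shaped.extremal shaped-b y₀′ y₀-extremal)
                                                                (hits-one x₀′ y₀′ z₀∈Λ hit)) ⟩
      + 1                                       ∎
      where
      open ≡-Reasoning
      open UniqueDecomposition ud
      w x₀′ y₀′ : Point
      w = toPoint (a ⊕ b) c
      x₀′ = toPoint a x₀
      y₀′ = toPoint b y₀
      hit : (x₀′ ⊞ y₀′) ⊞ toPoint (0 , 0) z₀ ≡ w
      hit = sym (trans (cong (toPoint (a ⊕ b)) (sym sum))
                  (trans (toPoint-translate (a ⊕ b) (x₀ ⊕ y₀) z₀)
                         (cong (_⊞ toPoint (0 , 0) z₀) (toPoint-⊕ a b x₀ y₀))))
      only : ∀ x y → ev Fa x ≢ + 0 → ev Fb y ≢ + 0 → hits w x y ≢ + 0 → x ≡ x₀′ × y ≡ y₀′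
      only x y evx≢0 evy≢0 hits≢0 with decompose w x y evx≢0 evy≢0 hits≢0
      ... | c′ , d , x≡ , y≡ , w≡ with toPoint-injective (a ⊕ b) {c} {c′} w≡
      ... | refl = let cx≡ , cy≡ = unique d in trans x≡ (cong (toPoint a) cx≡) , trans y≡ (cong (toPoint b) cy≡)

  module FareyStep {qa pa qb pb : ℕ} {s′ : Frac} (adj : Adjacent (qa , pa) (qb , pb))
    (opposite : OppositeVertex s′ ((qa , pa) ⊕ (qb , pb)) (toPoint ((qa , pa) ⊕ (qb , pb)) (qa , pb)))
    {Fa Fb Fs′ : FS} (shaped-a : Shaped (qa , pa) Fa) (shaped-b : Shaped (qb , pb) Fb)
    (shaped-s′ : Shaped s′ Fs′)
    where

    open OppositeVertex opposite

    s : Frac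
    s = (qa , pa) ⊕ (qb , pb)

    u : Point
    u = toPoint s (qa , pb)

    Fs : FS
    Fs = ((Fa ⋆ Fb) ⋆ 𝟙Λ) ⊖ Fs′

    ev-Fs : ∀ w → ev Fs w ≡ ev ((Fa ⋆ Fb) ⋆ 𝟙Λ) w - ev Fs′ w
    ev-Fs = ev-⊖ ((Fa ⋆ Fb) ⋆ 𝟙Λ) Fs′

    Fs′-vanishes : ∀ w → ¬ w ∈J s′ → ev Fs′ w ≡ + 0
    Fs′-vanishes w w∉J′ with ev Fs′ w ℤ.≟ + 0
    ... | yes ev≡0 = ev≡0
    ... | no  ev≢0 = contradiction (Shaped.support shaped-s′ w ev≢0) w∉J′

    escapes-to-u : ∀ {c} → ¬ toPoint s c ∈J s → (d : Decomposition (qa , pa) (qb , pb) c) → c ≡ (qa , pb)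
    escapes-to-u {c} c∉J d@(decomposition _ _ _ sum) =
      let cx≡ , cy≡ , cz≡ = escape-unique adj d
                              (ℕ.≰⇒> λ area≤ → c∉J (InJᶜ⇒InJ s c (Decomposition-size d , area≤)))
      in trans (sym sum) (trans (cong₂ _⊕_ (cong₂ _⊕_ cx≡ cy≡) cz≡)
                                  (cong₂ _,_ (trans (ℕ.+-identityʳ _) (ℕ.+-identityʳ qa)) (ℕ.+-identityʳ pb)))

    vanishes-outside : ∀ w → ¬ w ∈J s → ev Fs w ≡ + 0
    vanishes-outside w w∉J with w ≟ᴾ u
    ... | yes refl = trans (ev-Fs u)
                       (cong₂ _-_ (ev-⋆-⋆Λ-unique shaped-a shaped-b
                                    (escape-corner adj λ u∈J → w∉J (InJᶜ⇒InJ s _ u∈J)))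
                                  (Shaped.extremal shaped-s′ u u-extremal))
    ... | no  w≢u  = trans (ev-Fs w)
                       (cong₂ _-_ (ev-⋆-⋆Λ-vanishes shaped-a shaped-b w unreachable)
                                  (Fs′-vanishes w λ w∈J′ → [ w∉J , w≢u ]′ (covered w w∈J′)))
      where
      unreachable : ∀ c → Decomposition (qa , pa) (qb , pb) c → w ≢ toPoint s c
      unreachable c d refl = w≢u (cong (toPoint s) (escapes-to-u w∉J d))

    support : ∀ w → ev Fs w ≢ + 0 → w ∈J s
    support w ev≢0 with InJ? (qa ℕ.+ qb) (pa ℕ.+ pb) w
    ... | yes w∈J = w∈J
    ... | no  w∉J = contradiction (vanishes-outside w w∉J) ev≢0

    corner-decomposition : ∀ {c} → Corner (qa ℕ.+ qb) (pa ℕ.+ pb) c →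
                           UniqueDecomposition (qa , pa) (qb , pb) c
    corner-decomposition P₀ = P₀-corner pb adj
    corner-decomposition P₁ = P₁-corner adj
    corner-decomposition Q₀ = Q₀-corner qa adj
    corner-decomposition Q₁ = Q₁-corner adj

    extremal-value : ∀ w → w ∈Ext s → ev Fs w ≡ + 1
    extremal-value w w∈Ext with extremal⇒corner w (mediant-q≢0 adj) (mediant-p≢0 adj) w∈Ext
    ... | c , corner , refl = trans (ev-Fs w)
                                (cong₂ _-_ (ev-⋆-⋆Λ-unique shaped-a shaped-b (corner-decomposition corner))
                                           (Fs′-vanishes w λ w∈J′ → avoids-extremal w w∈J′ w∈Ext))

    Fs-shaped : Shaped s Fs
    Fs-shaped = shaped support extremal-value

-- Descent in the Farey tree

module _ where
  open import Data.Nat.Base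
  open import Data.Nat.Properties
  open import Data.Nat.Tactic.RingSolver using (solve-∀)
  open import Data.Nat.Divisibility using (_∣_; ∣-antisym; ∣-refl; _∣0; m∣m*n; n∣m*n)
  open import Data.Nat.Coprimality as Coprimality using (coprime-divisor; 0-coprimeTo-m⇒m≡1)
  open import Data.Bool.Base using (T; true; false)

  record Gap (a b : Frac) (d : ℕ) : Set where
    constructor gap
    field cross : proj₁ a * proj₂ b + d ≡ proj₁ b * proj₂ a

  data CmpView (a b : ℕ) : Cmp → Set where
    is-lt : a < b → CmpView a b lt
    is-eq : a ≡ b → CmpView a b eq
    is-gt : b < a → CmpView a b gt

  cmp-view : ∀ a b → CmpView a b (cmp a b)
  cmp-view a b with a <ᵇ b in a<ᵇb | b <ᵇ a in b<ᵇa
  ... | true  | _     = is-lt (<ᵇ⇒< a b (subst T (sym a<ᵇb) _))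
  ... | false | true  = is-gt (<ᵇ⇒< b a (subst T (sym b<ᵇa) _))
  ... | false | false =
    is-eq (≤-antisym (≮⇒≥ λ b<a → subst T b<ᵇa (<⇒<ᵇ b<a)) (≮⇒≥ λ a<b → subst T a<ᵇb (<⇒<ᵇ a<b)))

  same-slope : ∀ {q p q′ p′} → Coprime q p → Coprime q′ p′ → q * p′ ≡ q′ * p →
               (q , p) ≡ (q′ , p′)
  same-slope {q} {p} {q′} {p′} coprime coprime′ cross = cong₂ _,_
    (∣-antisym (coprime-divisor coprime (subst (q ∣_) (trans cross (*-comm q′ p)) (m∣m*n p′)))
               (coprime-divisor coprime′ (subst (q′ ∣_) (trans (sym cross) (*-comm q p′)) (m∣m*n p))))
    (∣-antisym (coprime-divisor (Coprimality.sym coprime) (subst (p ∣_) (sym cross) (n∣m*n q′)))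
               (coprime-divisor (Coprimality.sym coprime′) (subst (p′ ∣_) cross (n∣m*n q))))

  <⇒gap : ∀ {a b} → a < b → ∃[ k ] a + suc k ≡ b
  <⇒gap {a} a<b = let k , a+1+k≡b = m≤n⇒∃[o]m+o≡n a<b in k , trans (+-suc a k) a+1+k≡b

  module _ {q p ql pl qr pr A B : ℕ} (gapˡ : Gap (ql , pl) (q , p) A) (gapʳ : Gap (q , p) (qr , pr) B) where

    private
      crossˡ : ql * p + A ≡ q * pl
      crossˡ = Gap.cross gapˡ
      crossʳ : q * pr + B ≡ qr * p
      crossʳ = Gap.cross gapʳ

    gap-shrinks-left : ∀ {B′} → Gap (q , p) ((ql , pl) ⊕ (qr , pr)) B′ → B′ + A ≡ B
    gap-shrinks-left {B′} (gap crossᵐ) = +-cancelˡ-≡ (q * pr) _ _ (+-cancelʳ-≡ (ql * p) _ _ (begin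
      (q * pr + (B′ + A)) + ql * p  ≡⟨ regroup q pr B′ A ql p ⟩
      (ql * p + A) + q * pr + B′    ≡⟨ cong (λ t → t + q * pr + B′) crossˡ ⟩
      q * pl + q * pr + B′          ≡⟨ cong (_+ B′) (*-distribˡ-+ q pl pr) ⟨
      q * (pl + pr) + B′            ≡⟨ crossᵐ ⟩
      (ql + qr) * p                 ≡⟨ split ql qr p ⟩
      qr * p + ql * p               ≡⟨ cong (_+ ql * p) crossʳ ⟨
      (q * pr + B) + ql * p         ∎))
      where
      open ≡-Reasoning
      regroup : ∀ q pr B′ A ql p → (q * pr + (B′ + A)) + ql * p ≡ (ql * p + A) + q * pr + B′
      regroup = solve-∀
      split : ∀ ql qr p → (ql + qr) * p ≡ qr * p + ql * p
      split = solve-∀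

    gap-shrinks-right : ∀ {A′} → Gap ((ql , pl) ⊕ (qr , pr)) (q , p) A′ → A′ + B ≡ A
    gap-shrinks-right {A′} (gap crossᵐ) = +-cancelˡ-≡ (ql * p) _ _ (+-cancelʳ-≡ (qr * p) _ _ (begin
      (ql * p + (A′ + B)) + qr * p  ≡⟨ regroup ql qr p A′ B ⟩
      ((ql + qr) * p + A′) + B      ≡⟨ cong (_+ B) crossᵐ ⟩
      q * (pl + pr) + B             ≡⟨ split q pl pr B ⟩
      q * pl + (q * pr + B)         ≡⟨ cong (_+_ (q * pl)) crossʳ ⟩
      q * pl + qr * p               ≡⟨ cong (_+ qr * p) crossˡ ⟨
      (ql * p + A) + qr * p         ∎))
      where
      open ≡-Reasoning
      regroup : ∀ ql qr p A′ B → (ql * p + (A′ + B)) + qr * p ≡ ((ql + qr) * p + A′) + B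
      regroup = solve-∀
      split : ∀ q pl pr B → q * (pl + pr) + B ≡ q * pl + (q * pr + B)
      split = solve-∀

  fuel-shrinksˡ : ∀ w x {y z n} → x + suc y ≡ z → w + z ≤ suc n → w + x ≤ n
  fuel-shrinksˡ w x x+y+1≡z w+z≤ =
    ≤-pred (<-≤-trans (+-monoʳ-< w (subst (x <_) x+y+1≡z (m<m+n x z<s))) w+z≤)

  fuel-shrinksʳ : ∀ x w {y z n} → x + suc y ≡ z → z + w ≤ suc n → x + w ≤ n
  fuel-shrinksʳ x w x+y+1≡z z+w≤ =
    ≤-pred (<-≤-trans (+-monoˡ-< w (subst (x <_) x+y+1≡z (m<m+n x z<s))) z+w≤)

  -- The gaps are the determinants of q/p against l and r. Their sum is q + p at the root of the Farey
  -- tree, which is the fuel given by F, and drops by at least one at each step of the descent.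
  descend-shaped : ∀ n {q p ql pl qr pr A B Fl Fr Fm} → Coprime q p → Adjacent (ql , pl) (qr , pr) →
    Shaped (ql , pl) Fl → Shaped (qr , pr) Fr → Shaped ((ql , pl) ⊕ (qr , pr)) Fm →
    Gap (ql , pl) (q , p) (suc A) → Gap (q , p) (qr , pr) (suc B) → suc A + suc B ≤ n →
    Shaped (q , p) (descend n (q , p) (ql , pl) (qr , pr) Fl Fr Fm)
  descend-shaped zero _ _ _ _ _ _ _ ()
  descend-shaped (suc n) {q} {p} {ql} {pl} {qr} {pr} {A} {B} {Fm = Fm}
                 coprime adj shaped-l shaped-r shaped-m gapˡ gapʳ fuel
    with cmp (q * (pl + pr)) ((ql + qr) * p) | cmp-view (q * (pl + pr)) ((ql + qr) * p)
  ... | eq | is-eq cross =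
    subst (λ t → Shaped t Fm) (sym (same-slope coprime (adjacent-coprime (adjacent-mediantˡ adj)) cross)) shaped-m
  ... | lt | is-lt t<m =
    let k , crossᵐ = <⇒gap t<m ; gapᵐ = gap crossᵐ in
    descend-shaped n coprime (adjacent-mediantˡ adj) shaped-l shaped-m
      (FareyStep.Fs-shaped (adjacent-mediantˡ adj) (opposite-of-left-child adj) shaped-l shaped-m shaped-r)
      gapˡ gapᵐ
      (fuel-shrinksˡ (suc A) (suc k) (gap-shrinks-left gapˡ gapʳ gapᵐ) fuel)
  ... | gt | is-gt m<t =
    let k , crossᵐ = <⇒gap m<t ; gapᵐ = gap crossᵐ in
    descend-shaped n coprime (adjacent-mediantʳ adj) shaped-m shaped-r
      (FareyStep.Fs-shaped (adjacent-mediantʳ adj) (opposite-of-right-child adj) shaped-m shaped-r shaped-l)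
      gapᵐ gapʳ
      (fuel-shrinksʳ (suc k) (suc B) (gap-shrinks-right gapˡ gapʳ gapᵐ) fuel)

  𝟙J-support : ∀ q p x → ev (𝟙J q p) x ≢ + 0 → InJ q p x
  𝟙J-support q p x = ev-support (𝟙J q p) x (All.map⁺ (All.all-filter (InJ? q p) box))
    where
    box : List Point
    box = concatMap (λ α → map (λ β → (α , β)) (range (ℤ.- (+ p)) (2 * (p + q))))
                    (range (ℤ.- (+ q)) (2 * (p + q)))

  point-shaped : ∀ q p → q + p ≡ 1 → ev (𝟙J q p) (toPoint (q , p) (0 , 0)) ≡ + 1 →
                 Shaped (q , p) (𝟙J q p)
  point-shaped q p q+p≡1 value = shaped (𝟙J-support q p) extremal
    where
    extremal : ∀ x → x ∈Ext (q , p) → ev (𝟙J q p) x ≡ + 1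
    extremal x (inj₁ (q≢0 , p≢0 , _)) =
      contradiction (subst (2 ≤_) q+p≡1 (+-mono-≤ (n≢0⇒n>0 q≢0) (n≢0⇒n>0 p≢0))) λ { (s≤s ()) }
    extremal x (inj₂ (_ , x∈J)) with InJ⇒InJᶜ (q , p) x x∈J
    ... | (m , n) , refl , (size< , _)
            with size<1 {m , n} (subst (suc (m + n) ≤_) q+p≡1 size<)
    ... | refl = value

  𝟙J-shaped-1 : Shaped (1 , 1) (𝟙J 1 1)
  𝟙J-shaped-1 = shaped (𝟙J-support 1 1) extremal
    where
    extremal : ∀ x → x ∈Ext (1 , 1) → ev (𝟙J 1 1) x ≡ + 1
    extremal x (inj₁ (_ , _ , inj₁ refl))               = refl
    extremal x (inj₁ (_ , _ , inj₂ (inj₁ refl)))        = refl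
    extremal x (inj₁ (_ , _ , inj₂ (inj₂ (inj₁ refl)))) = refl
    extremal x (inj₁ (_ , _ , inj₂ (inj₂ (inj₂ refl)))) = refl
    extremal x (inj₂ (inj₁ () , _))
    extremal x (inj₂ (inj₂ () , _))

  F-shaped : ∀ q p → Coprime q p → Shaped (q , p) (F q p)
  F-shaped q zero coprime with coprime (∣-refl , q ∣0)
  ... | refl = point-shaped 1 0 refl refl
  F-shaped zero (suc p) coprime with 0-coprimeTo-m⇒m≡1 coprime
  ... | refl = point-shaped 0 1 refl refl
  F-shaped (suc q) (suc p) coprime =
    descend-shaped (suc q + suc p) coprime (adjacent refl)
      (point-shaped 0 1 refl refl) (point-shaped 1 0 refl refl) 𝟙J-shaped-1
      (gap (sym (*-identityʳ (suc q)))) (gap (trans (cong (_+ suc p) (*-zeroʳ q)) (sym (+-identityʳ (suc p)))))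
      ≤-refl

lemma3p4 : (q p : ℕ) → Coprime q p →
    ((c : Point) → ev (F q p) c ≢ + 0 → InJ q p c) ×
    ((c : Point) → Extremal q p c → ev (F q p) c ≡ + 1)
lemma3p4 q p coprime = support , extremal
  where open Shaped (F-shaped q p coprime)
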